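{- Let $e$ be an even positive integer, $q=2^e$, $d=(q^2+q+1)/3$, and $\sigma(X)=X+X^d+X^{dq}\in\mathbb{F}_{q^2}[X]$ (a permutation polynomial of $\mathbb{F}_{q^2}$). For $\alpha\in\mathbb{F}_q^*$ let $f_\alpha(x)=\operatorname{Tr}_{q^2}\bigl(\alpha(\sigma^{ -1}(x))^3\bigr)$ for $x\in\mathbb{F}_{q^2}$. Then: (a) if $\alpha$ is a cube in $\mathbb{F}_q$, then $\{W_{f_\alpha}(\beta):\beta\in\mathbb{F}_q\}=\{2q,-2q\}$; (b) if $\alpha$ is not a cube in $\mathbb{F}_q$, then $\{W_{f_\alpha}(\beta):\beta\in\mathbb{F}_q\}=\{q\}$.
   Context: $\operatorname{Tr}_q$ and $\operatorname{Tr}_{q^2}$ denote the absolute traces from $\mathbb{F}_q$ and $\mathbb{F}_{q^2}$ to $\mathbb{F}_2$; $\sigma^{ -1}$ is the compositional inverse of the permutation of $\mathbb{F}_{q^2}$ induced by $\sigma$. For a Boolean function $f$ on $\mathbb{F}_{q^2}$, its Walsh transform is $W_f(\beta)=\sum_{x\in\mathbb{F}_{q^2}}(-1)^{f(x)+\operatorname{Tr}_{q^2}(\beta x)}$ for $\beta\in\mathbb{F}_{q^2}$. -}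

module Defs where

open import Level using (Level; suc; _⊔_)
open import Data.Nat as ℕ using (ℕ; zero; suc)
open import Data.Nat.DivMod using (_/_)
open import Data.Fin using (Fin)
open import Data.Fin.Base using () renaming (toℕ to toℕᶠ)
open import Data.List using (List; map; foldr; allFin; upTo)
open import Data.Integer as ℤ using (ℤ)
open import Data.Product using (Σ; _×_; _,_)
open import Relation.Binary.PropositionalEquality using (_≡_)
open import Relation.Nullary using (¬_; Dec; yes; no)
open import Algebra.Structures using (IsCommutativeRing)
open import Function.Bundles using (_↔_; Inverse)

record FiniteField (N : ℕ) : Set₁ where
  infixl 7 _*_
  infixl 6 _+_
  field
    Carrier : Set
    _+_ _*_ : Carrier → Carrier → Carrier
    -_ : Carrier → Carrier
    0# 1# : Carrier
    isCommutativeRing : IsCommutativeRing _≡_ _+_ _*_ -_ 0# 1#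
    0≢1 : ¬ (0# ≡ 1#)
    inverse : ∀ x → ¬ (x ≡ 0#) → Σ Carrier (λ y → x * y ≡ 1#)
    _≟_ : (x y : Carrier) → Dec (x ≡ y)
    enum : Fin N ↔ Carrier

  _^_ : Carrier → ℕ → Carrier
  x ^ zero = 1#
  x ^ suc n = x * (x ^ n)

  elements : List Carrier
  elements = map (Inverse.to enum) (allFin N)

module _ (e : ℕ) where
  qOf : ℕ
  qOf = 2 ℕ.^ e

  dOf : ℕ
  dOf = (qOf ℕ.* qOf ℕ.+ qOf ℕ.+ 1) / 3

module FieldDefs (e : ℕ) (F : FiniteField (2 ℕ.^ (2 ℕ.* e))) where
  open FiniteField F

  q : ℕ
  q = qOf e

  d : ℕ
  d = dOf e

  InFq : Carrier → Set
  InFq x = x ^ q ≡ x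

  -- x is a cube in F_q (x assumed in F_q)
  IsCubeInFq : Carrier → Set
  IsCubeInFq x = Σ Carrier (λ y → InFq y × (y ^ 3 ≡ x))

  Tr : Carrier → Carrier
  Tr x = foldr (λ i acc → x ^ (2 ℕ.^ i) + acc) 0# (upTo (2 ℕ.* e))

  σ : Carrier → Carrier
  σ x = x + x ^ d + x ^ (d ℕ.* q)

  sign : Carrier → ℤ
  sign b with b ≟ 0#
  ... | yes _ = ℤ.+ 1
  ... | no _ = ℤ.- (ℤ.+ 1)

  W : (Carrier → Carrier) → Carrier → ℤ
  W f β = foldr (λ x acc → sign (f x + Tr (β * x)) ℤ.+ acc) (ℤ.+ 0) elements

  fα : (Carrier → Carrier) → Carrier → Carrier → Carrier
  fα σinv α x = Tr (α * (σinv x ^ 3))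

-- For β ∈ F_q the substitution x = σ(y) turns W_{f_α}(β) into the cubic sum
-- S(β) = Σ_y χ(α y³ + β y) with χ(z) = (-1)^Tr(z): the extra terms β y^d and β y^(dq) of
-- β σ(y) are conjugate over F_q, so their characters cancel. Squaring and shifting y by a,
-- S(β)² = Σ_a χ(α a³ + β a) Σ_y χ(y² C(a)) with C(a) = α a + α² a⁴, and the inner sum is
-- q² or 0 according as C(a) = 0 or not. The zeros of C are 0 and the solutions of α a³ = 1;
-- there are none of the latter unless α is a cube y³, and then the zeros are y⁻¹ F₄ ⊆ F_q
-- (e is even), where the outer character is trivial. Hence S(β)² is q² or (2q)². Finally
-- Σ_{β ∈ F_q} S(β) = q², because summing χ(β y) over β ∈ F_q keeps only y ∈ F_q, where
-- α y³ has trace 0; this forces S ≡ q for non-cubes and both signs ±2q for cubes.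
-- The field facts used (Fermat, characteristic 2, an element of trace 1, a primitive cube
-- root of unity) are derived from the finite-field axioms, the last two from the bound on
-- the number of roots of a polynomial.

module Submission where

open import Defs
open import Level using (0ℓ)
open import Algebra.Bundles using (CommutativeMonoid; CommutativeRing)
open import Algebra.Structures using (IsCommutativeMonoid; IsCommutativeRing)
import Algebra.Definitions.RawMonoid as RawMonoidDefinitions
import Algebra.Properties.CommutativeMonoid.Sum as CommutativeMonoidSum
import Algebra.Properties.Monoid.Mult as MonoidMult
import Algebra.Properties.Semiring.Sum as SemiringSum
import Algebra.Properties.Group as GroupProperties
import Algebra.Solver.Ring.NaturalCoefficients.Default as NaturalCoefficientSolver
open import Data.Fin as Fin using (Fin; punchIn)
open import Data.Fin.Properties using (punchInᵢ≢i; ¬∀⟶∃¬; nonZeroIndex)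
import Data.Integer as ℤ
open ℤ using (ℤ; 0ℤ; 1ℤ; -1ℤ)
import Data.Integer.Properties as ℤ
open import Data.Integer.Tactic.RingSolver using (solve-∀)
open import Data.List as List using (List; []; _∷_; foldr; map; allFin; tabulate; length; replicate; _++_; upTo; _∷ʳ_)
open import Data.List.Properties using (map-tabulate; length-map; length-tabulate; length-++; length-replicate; applyUpTo-∷ʳ; foldr-∷ʳ)
open import Data.List.Membership.Propositional using (_∈_)
open import Data.List.Membership.Propositional.Properties using (∈-map⁺; ∈-map⁻)
import Data.List.Membership.DecPropositional as DecMembership
open import Data.List.Relation.Unary.All as All using (All; []; _∷_)
open import Data.List.Relation.Unary.All.Properties using (All¬⇒¬Any; map⁺)
open import Data.List.Relation.Unary.AllPairs using ([]; _∷_)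
open import Data.List.Relation.Unary.Any using (here; there)
open import Data.List.Relation.Unary.Unique.Propositional using (Unique)
import Data.List.Relation.Unary.Unique.Propositional.Properties as Unique
open import Data.Nat as ℕ using (ℕ; zero; suc; NonZero; z≤n; s≤s)
import Data.Nat.Properties as ℕ
open import Data.Nat.Solver using (module +-*-Solver)
open import Data.Product using (Σ; ∃; _×_; _,_; proj₁; proj₂)
open import Data.Sum as ⊎ using (_⊎_; inj₁; inj₂; [_,_]′)
open import Function using (_∘_; id; flip; _↔_; Inverse; mk↔ₛ′; _⇔_; mk⇔; Equivalence)
open import Relation.Binary.Definitions using (DecidableEquality)
open import Relation.Binary.PropositionalEquality
open import Relation.Nullary using (¬_; Dec; yes; no; contradiction)

i*i≡j*j⇒i≡j⊎i≡-j : ∀ i j → i ℤ.* i ≡ j ℤ.* j → i ≡ j ⊎ i ≡ ℤ.- j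
i*i≡j*j⇒i≡j⊎i≡-j i j i²≡j² with ℤ.i*j≡0⇒i≡0∨j≡0 (i ℤ.- j) (trans (difference-of-squares i j) (ℤ.i≡j⇒i-j≡0 i²≡j²))
  where
  difference-of-squares : ∀ i j → (i ℤ.- j) ℤ.* (i ℤ.+ j) ≡ i ℤ.* i ℤ.- j ℤ.* j
  difference-of-squares = solve-∀
... | inj₁ i-j≡0 = inj₁ (ℤ.i-j≡0⇒i≡j i j i-j≡0)
... | inj₂ i+j≡0 = inj₂ (ℤ.i-j≡0⇒i≡j i (ℤ.- j) (trans (cong (ℤ._+_ i) (ℤ.neg-involutive j)) i+j≡0))

nonneg-square-root : ∀ {i} n → 0ℤ ℤ.≤ i → i ℤ.* i ≡ ℤ.+ n ℤ.* ℤ.+ n → i ≡ ℤ.+ n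
nonneg-square-root {i} n 0≤i i²≡n² with i*i≡j*j⇒i≡j⊎i≡-j i (ℤ.+ n) i²≡n²
... | inj₁ i≡n = i≡n
... | inj₂ i≡-n with n
...   | zero = i≡-n
...   | suc _ = contradiction (subst (0ℤ ℤ.≤_) i≡-n 0≤i) λ ()

module Enumeration {n : ℕ} {A : Set} (enum : Fin n ↔ A) where

  open Inverse enum using (to; from)

  to∘from : ∀ x → to (from x) ≡ x
  to∘from = Inverse.strictlyInverseˡ enum

  from∘to : ∀ i → from (to i) ≡ i
  from∘to = Inverse.strictlyInverseʳ enum

  elements : List A
  elements = map to (allFin n)

  elements-unique : Unique elements
  elements-unique = Unique.map⁺ to-injective (Unique.allFin⁺ n)
    where
    to-injective : ∀ {i j} → to i ≡ to j → i ≡ j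
    to-injective {i} {j} eq = trans (sym (from∘to i)) (trans (cong from eq) (from∘to j))

  length-elements : length elements ≡ n
  length-elements = trans (length-map to (allFin n)) (length-tabulate id)

  counterexample : {P : A → Set} → (∀ x → Dec (P x)) → ¬ (∀ x → P x) → ∃ λ x → ¬ P x
  counterexample {P} P? ¬∀P with ¬∀⟶∃¬ n (P ∘ to) (P? ∘ to) (λ ∀P → ¬∀P (λ x → subst P (to∘from x) (∀P (from x))))
  ... | i , ¬Pi = to i , ¬Pi

  module Sum {M : Set} {_∙_ : M → M → M} {ε : M} (isCommutativeMonoid : IsCommutativeMonoid _≡_ _∙_ ε) where

    private
      commutativeMonoid : CommutativeMonoid 0ℓ 0ℓ
      commutativeMonoid = record { isCommutativeMonoid = isCommutativeMonoid }
      open CommutativeMonoid commutativeMonoid using (identityʳ)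
      open CommutativeMonoidSum commutativeMonoid
        using (sum; sum-cong-≗; ∑-distrib-+; ∑-permute; sum-replicate; sum-replicate-zero; sum-remove)
        renaming (∑-comm to sum-comm)

    open RawMonoidDefinitions (CommutativeMonoid.rawMonoid commutativeMonoid) public using () renaming (_×_ to _·_)
    open MonoidMult (CommutativeMonoid.monoid commutativeMonoid) public using () renaming (×-homo-+ to ·-homo-+)

    ∑ : (A → M) → M
    ∑ g = sum (g ∘ to)

    ∑-cong : ∀ {f g : A → M} → (∀ x → f x ≡ g x) → ∑ f ≡ ∑ g
    ∑-cong f≗g = sum-cong-≗ (f≗g ∘ to)

    ∑-reindex : (π π⁻¹ : A → A) → (∀ x → π (π⁻¹ x) ≡ x) → (∀ x → π⁻¹ (π x) ≡ x) →
                (g : A → M) → ∑ (g ∘ π) ≡ ∑ g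
    ∑-reindex π π⁻¹ π∘π⁻¹ π⁻¹∘π g =
      sym (trans (∑-permute (g ∘ to) permutation) (sum-cong-≗ (λ i → cong g (to∘from (π (to i))))))
      where
      permutation : Fin n ↔ Fin n
      permutation = mk↔ₛ′ (from ∘ π ∘ to) (from ∘ π⁻¹ ∘ to)
        (λ i → trans (cong (from ∘ π) (to∘from _)) (trans (cong from (π∘π⁻¹ _)) (from∘to i)))
        (λ i → trans (cong (from ∘ π⁻¹) (to∘from _)) (trans (cong from (π⁻¹∘π _)) (from∘to i)))

    ∑-reindex-involution : (π : A → A) → (∀ x → π (π x) ≡ x) → (g : A → M) → ∑ (g ∘ π) ≡ ∑ g
    ∑-reindex-involution π π∘π = ∑-reindex π π π∘π π∘π

    ∑-distrib : (f g : A → M) → ∑ (λ x → f x ∙ g x) ≡ ∑ f ∙ ∑ g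
    ∑-distrib f g = ∑-distrib-+ (f ∘ to) (g ∘ to)

    ∑-comm : (f : A → A → M) → ∑ (λ x → ∑ (f x)) ≡ ∑ (λ y → ∑ (λ x → f x y))
    ∑-comm f = sum-comm (λ i j → f (to i) (to j))

    ∑-closed : (P : M → Set) → P ε → (∀ {x y} → P x → P y → P (x ∙ y)) → (g : A → M) → (∀ x → P (g x)) → P (∑ g)
    ∑-closed P Pε P∙ g Pg = go (g ∘ to) (Pg ∘ to)
      where
      go : ∀ {k} (t : Fin k → M) → (∀ i → P (t i)) → P (sum t)
      go {zero} t Pt = Pε
      go {suc k} t Pt = P∙ (Pt Fin.zero) (go (t ∘ Fin.suc) (Pt ∘ Fin.suc))

    ∑-const : (c : M) → ∑ (λ _ → c) ≡ n · c
    ∑-const c = sum-replicate n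

    ∑-zero : (g : A → M) → (∀ x → g x ≡ ε) → ∑ g ≡ ε
    ∑-zero g g≗ε = trans (sum-cong-≗ (g≗ε ∘ to)) (sum-replicate-zero n)

    ∑-single : (g : A → M) (p : A) → (∀ x → ¬ x ≡ p → g x ≡ ε) → ∑ g ≡ g p
    ∑-single g p vanishes = go enum refl
      where
      go : ∀ {m} → Fin m ↔ A → m ≡ n → ∑ g ≡ g p
      go {zero} en _ with Inverse.from en p
      ... | ()
      go {suc m} _ refl = trans (sum-remove {i = i} (g ∘ to)) (trans (cong (g (to i) ∙_) rest) (trans (identityʳ _) (cong g (to∘from p))))
        where
        i = from p
        rest = trans (sum-cong-≗ (λ j → vanishes (to (punchIn i j)) (λ eq → punchInᵢ≢i i j (trans (sym (from∘to _)) (cong from eq)))))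
                     (sum-replicate-zero m)

    foldr-elements : (g : A → M) → foldr (λ x acc → g x ∙ acc) ε elements ≡ ∑ g
    foldr-elements g = trans (cong (foldr (λ x acc → g x ∙ acc) ε) (map-tabulate id to)) (foldr-tabulate to)
      where
      foldr-tabulate : ∀ {k} (h : Fin k → A) → foldr (λ x acc → g x ∙ acc) ε (tabulate h) ≡ sum (g ∘ h)
      foldr-tabulate {zero} h = refl
      foldr-tabulate {suc k} h = cong (g (h Fin.zero) ∙_) (foldr-tabulate (h ∘ Fin.suc))

  module IntegerSum where

    open Sum ℤ.+-0-isCommutativeMonoid public
    open SemiringSum ℤ.+-*-semiring using (sum; *-distribˡ-sum)

    ∑-*ˡ : ∀ c (g : A → ℤ) → ∑ (λ x → c ℤ.* g x) ≡ c ℤ.* ∑ g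
    ∑-*ˡ c g = sym (*-distribˡ-sum c (g ∘ to))

    ∑-*ʳ : ∀ c (g : A → ℤ) → ∑ (λ x → g x ℤ.* c) ≡ ∑ g ℤ.* c
    ∑-*ʳ c g = trans (∑-cong (λ x → ℤ.*-comm (g x) c)) (trans (∑-*ˡ c g) (ℤ.*-comm c _))

    ∑-one : ∑ (λ _ → 1ℤ) ≡ ℤ.+ n
    ∑-one = trans (∑-const 1ℤ) (·-one n)
      where
      ·-one : ∀ k → k · 1ℤ ≡ ℤ.+ k
      ·-one zero = refl
      ·-one (suc k) = cong (ℤ._+_ 1ℤ) (·-one k)

    ∑-antisymmetric : (π : A → A) → (∀ x → π (π x) ≡ x) → (g : A → ℤ) → (∀ x → g (π x) ≡ ℤ.- g x) → ∑ g ≡ 0ℤ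
    ∑-antisymmetric π π∘π g g∘π≡-g = ℤ.*-cancelˡ-≡ (ℤ.+ 2) (∑ g) 0ℤ (begin
        ℤ.+ 2 ℤ.* ∑ g              ≡⟨ double (∑ g) ⟩
        ∑ g ℤ.+ ∑ g                ≡⟨ cong (ℤ._+ ∑ g) (sym (∑-reindex-involution π π∘π g)) ⟩
        ∑ (g ∘ π) ℤ.+ ∑ g          ≡⟨ sym (∑-distrib (g ∘ π) g) ⟩
        ∑ (λ x → g (π x) ℤ.+ g x)  ≡⟨ ∑-zero _ (λ x → trans (cong (ℤ._+ g x) (g∘π≡-g x)) (ℤ.+-inverseˡ (g x))) ⟩
        0ℤ                         ∎)
      where
      open ≡-Reasoning
      double : ∀ i → ℤ.+ 2 ℤ.* i ≡ i ℤ.+ i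
      double = solve-∀

    ∑≢0⇒∃≢0 : (g : A → ℤ) → ¬ ∑ g ≡ 0ℤ → ∃ λ x → ¬ g x ≡ 0ℤ
    ∑≢0⇒∃≢0 g ∑g≢0 = counterexample (λ x → g x ℤ.≟ 0ℤ) (∑g≢0 ∘ ∑-zero g)

    ∑-nonneg-≡0 : (g : A → ℤ) → (∀ x → 0ℤ ℤ.≤ g x) → ∑ g ≡ 0ℤ → ∀ x → g x ≡ 0ℤ
    ∑-nonneg-≡0 g g≥0 ∑g≡0 x = trans (cong g (sym (to∘from x))) (sum-nonneg-≡0 (g ∘ to) (g≥0 ∘ to) ∑g≡0 (from x))
      where
      sum-nonneg : ∀ {k} (t : Fin k → ℤ) → (∀ i → 0ℤ ℤ.≤ t i) → 0ℤ ℤ.≤ sum t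
      sum-nonneg {zero} t t≥0 = ℤ.≤-refl
      sum-nonneg {suc k} t t≥0 = ℤ.+-mono-≤ (t≥0 Fin.zero) (sum-nonneg (t ∘ Fin.suc) (t≥0 ∘ Fin.suc))
      sum-nonneg-≡0 : ∀ {k} (t : Fin k → ℤ) → (∀ i → 0ℤ ℤ.≤ t i) → sum t ≡ 0ℤ → ∀ i → t i ≡ 0ℤ
      sum-nonneg-≡0 {suc k} t t≥0 sum≡0 = λ where
          Fin.zero → head≡0
          (Fin.suc i) → sum-nonneg-≡0 (t ∘ Fin.suc) (t≥0 ∘ Fin.suc) tail≡0 i
        where
        tail≥0 = sum-nonneg (t ∘ Fin.suc) (t≥0 ∘ Fin.suc)
        head≡0 : t Fin.zero ≡ 0ℤ
        head≡0 = ℤ.≤-antisym (subst (t Fin.zero ℤ.≤_) sum≡0 head≤sum) (t≥0 Fin.zero)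
          where
          head≤sum = subst (ℤ._≤ sum t) (ℤ.+-identityʳ (t Fin.zero)) (ℤ.+-monoʳ-≤ (t Fin.zero) tail≥0)
        tail≡0 : sum (t ∘ Fin.suc) ≡ 0ℤ
        tail≡0 = trans (sym (ℤ.+-identityˡ _)) (trans (cong (ℤ._+ sum (t ∘ Fin.suc)) (sym head≡0)) sum≡0)

    𝟙 : {P : Set} → Dec P → ℤ
    𝟙 (yes _) = 1ℤ
    𝟙 (no _) = 0ℤ

    0≤𝟙 : {P : Set} (P? : Dec P) → 0ℤ ℤ.≤ 𝟙 P?
    0≤𝟙 (yes _) = ℤ.+≤+ ℕ.z≤n
    0≤𝟙 (no _) = ℤ.≤-refl

    𝟙-yes : {P : Set} → P → (P? : Dec P) → 𝟙 P? ≡ 1ℤ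
    𝟙-yes p (yes _) = refl
    𝟙-yes p (no ¬p) = contradiction p ¬p

    𝟙-no : {P : Set} → ¬ P → (P? : Dec P) → 𝟙 P? ≡ 0ℤ
    𝟙-no ¬p (yes p) = contradiction p ¬p
    𝟙-no ¬p (no _) = refl

    𝟙*f≡𝟙 : {P : Set} (P? : Dec P) {f : ℤ} → (P → f ≡ 1ℤ) → 𝟙 P? ℤ.* f ≡ 𝟙 P?
    𝟙*f≡𝟙 (yes p) f≡1 = cong (1ℤ ℤ.*_) (f≡1 p)
    𝟙*f≡𝟙 (no _) f≡1 = refl

    𝟙-cong : {P Q : Set} → P ⇔ Q → (P? : Dec P) (Q? : Dec Q) → 𝟙 P? ≡ 𝟙 Q?
    𝟙-cong P⇔Q (yes p) Q? = sym (𝟙-yes (Equivalence.to P⇔Q p) Q?)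
    𝟙-cong P⇔Q (no ¬p) Q? = sym (𝟙-no (¬p ∘ Equivalence.from P⇔Q) Q?)

    module _ (_≟_ : DecidableEquality A) where

      open DecMembership _≟_ using (_∈?_)

      ∑-𝟙-≟ : (p : A) → ∑ (λ x → 𝟙 (x ≟ p)) ≡ 1ℤ
      ∑-𝟙-≟ p = trans (∑-single _ p (λ x x≢p → 𝟙-no x≢p (x ≟ p))) (𝟙-yes refl (p ≟ p))

      ∑-𝟙-∈ : (ps : List A) → Unique ps → ∑ (λ x → 𝟙 (x ∈? ps)) ≡ ℤ.+ length ps
      ∑-𝟙-∈ [] [] = ∑-zero _ (λ x → refl)
      ∑-𝟙-∈ (p ∷ ps) (p∉ps ∷ ps-unique) = begin
          ∑ (λ x → 𝟙 (x ∈? p ∷ ps))                      ≡⟨ ∑-cong split ⟩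
          ∑ (λ x → 𝟙 (x ≟ p) ℤ.+ 𝟙 (x ∈? ps))            ≡⟨ ∑-distrib (λ x → 𝟙 (x ≟ p)) (λ x → 𝟙 (x ∈? ps)) ⟩
          ∑ (λ x → 𝟙 (x ≟ p)) ℤ.+ ∑ (λ x → 𝟙 (x ∈? ps))  ≡⟨ cong₂ ℤ._+_ (∑-𝟙-≟ p) (∑-𝟙-∈ ps ps-unique) ⟩
          1ℤ ℤ.+ ℤ.+ length ps                           ∎
        where
        open ≡-Reasoning
        split : ∀ x → 𝟙 (x ∈? p ∷ ps) ≡ 𝟙 (x ≟ p) ℤ.+ 𝟙 (x ∈? ps)
        split x with x ≟ p | x ∈? ps
        ... | yes refl | yes p∈ps = contradiction p∈ps (All¬⇒¬Any p∉ps)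
        ... | yes refl | no _ = refl
        ... | no _ | yes _ = refl
        ... | no _ | no _ = refl

module FieldProperties {N : ℕ} (F : FiniteField N) where

  open FiniteField F public
  open IsCommutativeRing isCommutativeRing public
    using (+-assoc; +-comm; *-assoc; *-comm; +-identityˡ; +-identityʳ; *-identityˡ; *-identityʳ;
           zeroˡ; zeroʳ; distribˡ; distribʳ; -‿inverseˡ; -‿inverseʳ)

  commutativeRing : CommutativeRing 0ℓ 0ℓ
  commutativeRing = record { isCommutativeRing = isCommutativeRing }

  open NaturalCoefficientSolver (CommutativeRing.commutativeSemiring commutativeRing) public
  open GroupProperties (CommutativeRing.+-group commutativeRing) public using () renaming (∙-cancelˡ to +-cancelˡ)
  open Enumeration enum public using (counterexample; elements-unique; length-elements)

  module +-Sum = Enumeration.Sum enum (IsCommutativeRing.+-isCommutativeMonoid isCommutativeRing)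
  module *-Sum = Enumeration.Sum enum (IsCommutativeRing.*-isCommutativeMonoid isCommutativeRing)
  module ℤ-Sum = Enumeration.IntegerSum enum

  inv : (x : Carrier) → ¬ x ≡ 0# → Carrier
  inv x x≢0 = proj₁ (inverse x x≢0)

  x*inv≡1 : ∀ x (x≢0 : ¬ x ≡ 0#) → x * inv x x≢0 ≡ 1#
  x*inv≡1 x x≢0 = proj₂ (inverse x x≢0)

  inv*x≡1 : ∀ x (x≢0 : ¬ x ≡ 0#) → inv x x≢0 * x ≡ 1#
  inv*x≡1 x x≢0 = trans (*-comm _ _) (x*inv≡1 x x≢0)

  x*inv[y]*y≡x : ∀ x {y} (y≢0 : ¬ y ≡ 0#) → x * inv y y≢0 * y ≡ x
  x*inv[y]*y≡x x {y} y≢0 = trans (*-assoc _ _ _) (trans (cong (x *_) (inv*x≡1 y y≢0)) (*-identityʳ x))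

  *-cancelˡ : ∀ a {x y} → ¬ a ≡ 0# → a * x ≡ a * y → x ≡ y
  *-cancelˡ a {x} {y} a≢0 ax≡ay = begin
      x                    ≡⟨ sym (*-identityˡ x) ⟩
      1# * x               ≡⟨ cong (_* x) (sym (inv*x≡1 a a≢0)) ⟩
      (inv a a≢0 * a) * x  ≡⟨ *-assoc _ _ _ ⟩
      inv a a≢0 * (a * x)  ≡⟨ cong (inv a a≢0 *_) ax≡ay ⟩
      inv a a≢0 * (a * y)  ≡⟨ sym (*-assoc _ _ _) ⟩
      (inv a a≢0 * a) * y  ≡⟨ cong (_* y) (inv*x≡1 a a≢0) ⟩
      1# * y               ≡⟨ *-identityˡ y ⟩
      y                    ∎
    where open ≡-Reasoning

  x*y≡0⇒x≡0⊎y≡0 : ∀ x y → x * y ≡ 0# → x ≡ 0# ⊎ y ≡ 0#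
  x*y≡0⇒x≡0⊎y≡0 x y xy≡0 with x ≟ 0#
  ... | yes x≡0 = inj₁ x≡0
  ... | no x≢0 = inj₂ (*-cancelˡ x x≢0 (trans xy≡0 (sym (zeroʳ x))))

  *-nonzero : ∀ {x y} → ¬ x ≡ 0# → ¬ y ≡ 0# → ¬ x * y ≡ 0#
  *-nonzero x≢0 y≢0 xy≡0 with x*y≡0⇒x≡0⊎y≡0 _ _ xy≡0
  ... | inj₁ x≡0 = x≢0 x≡0
  ... | inj₂ y≡0 = y≢0 y≡0

  1≢0 : ¬ 1# ≡ 0#
  1≢0 = 0≢1 ∘ sym

  ^-+ : ∀ x m n → x ^ (m ℕ.+ n) ≡ x ^ m * x ^ n
  ^-+ x zero n = sym (*-identityˡ _)
  ^-+ x (suc m) n = trans (cong (x *_) (^-+ x m n)) (sym (*-assoc _ _ _))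

  ^-* : ∀ x m n → x ^ (m ℕ.* n) ≡ (x ^ m) ^ n
  ^-* x m zero = cong (x ^_) (ℕ.*-zeroʳ m)
  ^-* x m (suc n) = begin
      x ^ (m ℕ.* suc n)      ≡⟨ cong (x ^_) (ℕ.*-suc m n) ⟩
      x ^ (m ℕ.+ m ℕ.* n)    ≡⟨ ^-+ x m (m ℕ.* n) ⟩
      x ^ m * x ^ (m ℕ.* n)  ≡⟨ cong (x ^ m *_) (^-* x m n) ⟩
      x ^ m * (x ^ m) ^ n    ∎
    where open ≡-Reasoning

  *-^ : ∀ x y n → (x * y) ^ n ≡ x ^ n * y ^ n
  *-^ x y zero = sym (*-identityˡ 1#)
  *-^ x y (suc n) = trans (cong ((x * y) *_) (*-^ x y n))
    (solve 4 (λ x y a b → (x :* y) :* (a :* b) := (x :* a) :* (y :* b)) refl x y (x ^ n) (y ^ n))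

  1^n≡1 : ∀ n → 1# ^ n ≡ 1#
  1^n≡1 zero = refl
  1^n≡1 (suc n) = trans (*-identityˡ _) (1^n≡1 n)

  0^n≡0 : ∀ n → .{{NonZero n}} → 0# ^ n ≡ 0#
  0^n≡0 (suc n) = zeroˡ _

  ^-nonzero : ∀ {x} n → ¬ x ≡ 0# → ¬ x ^ n ≡ 0#
  ^-nonzero zero x≢0 = 1≢0
  ^-nonzero (suc n) x≢0 = *-nonzero x≢0 (^-nonzero n x≢0)

  x^n≡0⇒x≡0 : ∀ {x} n → x ^ n ≡ 0# → x ≡ 0#
  x^n≡0⇒x≡0 {x} n xⁿ≡0 with x ≟ 0#
  ... | yes x≡0 = x≡0
  ... | no x≢0 = contradiction xⁿ≡0 (^-nonzero n x≢0)

  x^1≡x : ∀ x → x ^ 1 ≡ x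
  x^1≡x = *-identityʳ

  x^2≡x*x : ∀ x → x ^ 2 ≡ x * x
  x^2≡x*x x = cong (x *_) (*-identityʳ x)

  x^3≡x*x*x : ∀ x → x ^ 3 ≡ x * x * x
  x^3≡x*x*x x = trans (cong (x *_) (x^2≡x*x x)) (sym (*-assoc _ _ _))

  x+y≡x⇒y≡0 : ∀ {x y} → x + y ≡ x → y ≡ 0#
  x+y≡x⇒y≡0 {x} {y} x+y≡x = +-cancelˡ x y 0# (trans x+y≡x (sym (+-identityʳ x)))

  instance
    N-nonZero : NonZero N
    N-nonZero = nonZeroIndex (Inverse.from enum 0#)

  N·1≡0 : N +-Sum.· 1# ≡ 0#
  N·1≡0 = trans (sym (+-Sum.∑-const 1#)) (x+y≡x⇒y≡0 (begin
      +-Sum.∑ id + +-Sum.∑ (λ _ → 1#)   ≡⟨ sym (+-Sum.∑-distrib id (λ _ → 1#)) ⟩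
      +-Sum.∑ (_+ 1#)                  ≡⟨ +-Sum.∑-reindex (_+ 1#) (_+ - 1#) (cancel (-‿inverseʳ 1#)) (cancel (-‿inverseˡ 1#)) id ⟩
      +-Sum.∑ id                       ∎))
    where
    open ≡-Reasoning
    cancel : ∀ {u v} → u + v ≡ 0# → ∀ x → (x + v) + u ≡ x
    cancel {u} {v} u+v≡0 x = trans (+-assoc _ _ _) (trans (cong (x +_) (trans (+-comm v u) u+v≡0)) (+-identityʳ x))

  if-zero_then_else_ : Carrier → Carrier → Carrier → Carrier
  if-zero x then a else b with x ≟ 0#
  ... | yes _ = a
  ... | no _ = b

  if-zero-yes : ∀ {x} a b → x ≡ 0# → (if-zero x then a else b) ≡ a
  if-zero-yes {x} a b x≡0 with x ≟ 0#
  ... | yes _ = refl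
  ... | no x≢0 = contradiction x≡0 x≢0

  if-zero-no : ∀ {x} a b → ¬ x ≡ 0# → (if-zero x then a else b) ≡ b
  if-zero-no {x} a b x≢0 with x ≟ 0#
  ... | yes x≡0 = contradiction x≡0 x≢0
  ... | no _ = refl

  ·-^ : ∀ n a → n *-Sum.· a ≡ a ^ n
  ·-^ zero a = refl
  ·-^ (suc n) a = cong (a *_) (·-^ n a)

  -- Multiplication by a ≢ 0 permutes the field and fixes 0, so it does not change
  -- ∏ unit, the product of the nonzero elements.
  ∏[x≢0]a≡1 : ∀ a → ¬ a ≡ 0# → *-Sum.∑ (λ x → if-zero x then 1# else a) ≡ 1#
  ∏[x≢0]a≡1 a a≢0 = *-cancelˡ ∏unit ∏unit≢0 (begin
      ∏unit * *-Sum.∑ scale             ≡⟨ *-comm _ _ ⟩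
      *-Sum.∑ scale * ∏unit             ≡⟨ sym (*-Sum.∑-distrib scale unit) ⟩
      *-Sum.∑ (λ x → scale x * unit x)  ≡⟨ sym (*-Sum.∑-cong unit-a*) ⟩
      *-Sum.∑ (λ x → unit (a * x))      ≡⟨ *-Sum.∑-reindex (a *_) (inv a a≢0 *_) (cancel (x*inv≡1 a a≢0)) (cancel (inv*x≡1 a a≢0)) unit ⟩
      ∏unit                             ≡⟨ sym (*-identityʳ ∏unit) ⟩
      ∏unit * 1#                        ∎)
    where
    open ≡-Reasoning
    unit scale : Carrier → Carrier
    unit x = if-zero x then 1# else x
    scale x = if-zero x then 1# else a
    ∏unit = *-Sum.∑ unit
    unit≢0 : ∀ x → ¬ unit x ≡ 0#
    unit≢0 x with x ≟ 0#
    ... | yes _ = 1≢0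
    ... | no x≢0 = x≢0
    ∏unit≢0 : ¬ ∏unit ≡ 0#
    ∏unit≢0 = *-Sum.∑-closed (λ y → ¬ y ≡ 0#) 1≢0 *-nonzero unit unit≢0
    unit-a* : ∀ x → unit (a * x) ≡ scale x * unit x
    unit-a* x with x ≟ 0#
    ... | yes x≡0 = trans (if-zero-yes 1# (a * x) (trans (cong (a *_) x≡0) (zeroʳ a))) (sym (*-identityˡ 1#))
    ... | no x≢0 = if-zero-no 1# (a * x) (*-nonzero a≢0 x≢0)
    cancel : ∀ {u v} → u * v ≡ 1# → ∀ x → u * (v * x) ≡ x
    cancel {u} {v} uv≡1 x = trans (sym (*-assoc _ _ _)) (trans (cong (_* x) uv≡1) (*-identityˡ x))

  x^N≡x : ∀ a → a ^ N ≡ a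
  x^N≡x a with a ≟ 0#
  ... | yes refl = 0^n≡0 N
  ... | no a≢0 = begin
      a ^ N                               ≡⟨ sym (trans (*-Sum.∑-const a) (·-^ N a)) ⟩
      *-Sum.∑ (λ _ → a)                   ≡⟨ *-Sum.∑-cong split ⟩
      *-Sum.∑ (λ x → scale x * atZero x)  ≡⟨ *-Sum.∑-distrib scale atZero ⟩
      *-Sum.∑ scale * *-Sum.∑ atZero      ≡⟨ cong₂ _*_ (∏[x≢0]a≡1 a a≢0) ∏atZero≡a ⟩
      1# * a                              ≡⟨ *-identityˡ a ⟩
      a                                   ∎
    where
    open ≡-Reasoning
    scale atZero : Carrier → Carrier
    scale x = if-zero x then 1# else a
    atZero x = if-zero x then a else 1#
    split : ∀ x → a ≡ scale x * atZero x
    split x with x ≟ 0#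
    ... | yes _ = sym (*-identityˡ a)
    ... | no _ = sym (*-identityʳ a)
    ∏atZero≡a : *-Sum.∑ atZero ≡ a
    ∏atZero≡a = trans (*-Sum.∑-single atZero 0# (λ x → if-zero-no a 1#)) (if-zero-yes a 1# refl)

module CharacteristicTwo {k : ℕ} (F : FiniteField (2 ℕ.^ k)) where

  open FieldProperties F public

  1+1≡0 : 1# + 1# ≡ 0#
  1+1≡0 = x^n≡0⇒x≡0 k (trans (sym (2^j·1≡[1+1]^j k)) N·1≡0)
    where
    open ≡-Reasoning
    2^j·1≡[1+1]^j : ∀ j → (2 ℕ.^ j) +-Sum.· 1# ≡ (1# + 1#) ^ j
    2^j·1≡[1+1]^j zero = +-identityʳ 1#
    2^j·1≡[1+1]^j (suc j) = begin
        (2 ℕ.^ j ℕ.+ (2 ℕ.^ j ℕ.+ 0)) +-Sum.· 1#                   ≡⟨ +-Sum.·-homo-+ 1# (2 ℕ.^ j) _ ⟩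
        (2 ℕ.^ j) +-Sum.· 1# + (2 ℕ.^ j ℕ.+ 0) +-Sum.· 1#          ≡⟨ cong₂ _+_ (2^j·1≡[1+1]^j j) (trans (cong (+-Sum._· 1#) (ℕ.+-identityʳ (2 ℕ.^ j))) (2^j·1≡[1+1]^j j)) ⟩
        (1# + 1#) ^ j + (1# + 1#) ^ j                            ≡⟨ solve 1 (λ t → t :+ t := (con 1 :+ con 1) :* t) refl _ ⟩
        (1# + 1#) ^ suc j                                        ∎

  x+x≡0 : ∀ x → x + x ≡ 0#
  x+x≡0 x = trans (solve 1 (λ x → x :+ x := (con 1 :+ con 1) :* x) refl x) (trans (cong (_* x) 1+1≡0) (zeroˡ x))

  x+y≡0⇒x≡y : ∀ {x y} → x + y ≡ 0# → x ≡ y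
  x+y≡0⇒x≡y {x} {y} x+y≡0 = begin
      x            ≡⟨ sym (+-identityʳ x) ⟩
      x + 0#       ≡⟨ cong (x +_) (sym (x+x≡0 y)) ⟩
      x + (y + y)  ≡⟨ sym (+-assoc _ _ _) ⟩
      (x + y) + y  ≡⟨ cong (_+ y) x+y≡0 ⟩
      0# + y       ≡⟨ +-identityˡ y ⟩
      y            ∎
    where open ≡-Reasoning

  x+[x+y]≡y : ∀ x y → x + (x + y) ≡ y
  x+[x+y]≡y x y = trans (sym (+-assoc _ _ _)) (trans (cong (_+ y) (x+x≡0 x)) (+-identityˡ y))

  [x+y]+y≡x : ∀ x y → (x + y) + y ≡ x
  [x+y]+y≡x x y = trans (+-assoc _ _ _) (trans (cong (x +_) (x+x≡0 y)) (+-identityʳ x))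

  square-+ : ∀ x y → (x + y) * (x + y) ≡ x * x + y * y
  square-+ x y = begin
      (x + y) * (x + y)                   ≡⟨ solve 2 (λ x y → (x :+ y) :* (x :+ y) := x :* x :+ y :* y :+ (con 1 :+ con 1) :* (x :* y)) refl x y ⟩
      x * x + y * y + (1# + 1#) * (x * y) ≡⟨ cong (λ t → x * x + y * y + t * (x * y)) 1+1≡0 ⟩
      x * x + y * y + 0# * (x * y)        ≡⟨ cong (x * x + y * y +_) (zeroˡ _) ⟩
      x * x + y * y + 0#                  ≡⟨ +-identityʳ _ ⟩
      x * x + y * y                       ∎
    where open ≡-Reasoning

  x^[2^[1+j]]≡[x*x]^[2^j] : ∀ j x → x ^ (2 ℕ.^ suc j) ≡ (x * x) ^ (2 ℕ.^ j)
  x^[2^[1+j]]≡[x*x]^[2^j] j x = trans (^-* x 2 (2 ℕ.^ j)) (cong (_^ (2 ℕ.^ j)) (x^2≡x*x x))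

  x^[2^[1+j]]≡[x^[2^j]]² : ∀ j x → x ^ (2 ℕ.^ suc j) ≡ x ^ (2 ℕ.^ j) * x ^ (2 ℕ.^ j)
  x^[2^[1+j]]≡[x^[2^j]]² j x = trans (cong (x ^_) (ℕ.*-comm 2 (2 ℕ.^ j))) (trans (^-* x (2 ℕ.^ j) 2) (x^2≡x*x _))

  frobenius : ∀ j x y → (x + y) ^ (2 ℕ.^ j) ≡ x ^ (2 ℕ.^ j) + y ^ (2 ℕ.^ j)
  frobenius zero x y = trans (x^1≡x _) (sym (cong₂ _+_ (x^1≡x x) (x^1≡x y)))
  frobenius (suc j) x y = begin
      (x + y) ^ (2 ℕ.^ suc j)                       ≡⟨ x^[2^[1+j]]≡[x*x]^[2^j] j (x + y) ⟩
      ((x + y) * (x + y)) ^ (2 ℕ.^ j)               ≡⟨ cong (_^ (2 ℕ.^ j)) (square-+ x y) ⟩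
      (x * x + y * y) ^ (2 ℕ.^ j)                   ≡⟨ frobenius j (x * x) (y * y) ⟩
      (x * x) ^ (2 ℕ.^ j) + (y * y) ^ (2 ℕ.^ j)     ≡⟨ sym (cong₂ _+_ (x^[2^[1+j]]≡[x*x]^[2^j] j x) (x^[2^[1+j]]≡[x*x]^[2^j] j y)) ⟩
      x ^ (2 ℕ.^ suc j) + y ^ (2 ℕ.^ suc j)         ∎
    where open ≡-Reasoning

  module _ .{{_ : NonZero k}} where

    √ : Carrier → Carrier
    √ x = x ^ (2 ℕ.^ ℕ.pred k)

    √x*√x≡x : ∀ x → √ x * √ x ≡ x
    √x*√x≡x x = trans (sym (x^[2^[1+j]]≡[x^[2^j]]² (ℕ.pred k) x)) (trans (cong (λ n → x ^ (2 ℕ.^ n)) (ℕ.suc-pred k)) (x^N≡x x))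

    √[x*x]≡x : ∀ x → √ (x * x) ≡ x
    √[x*x]≡x x = trans (sym (x^[2^[1+j]]≡[x*x]^[2^j] (ℕ.pred k) x)) (trans (cong (λ n → x ^ (2 ℕ.^ n)) (ℕ.suc-pred k)) (x^N≡x x))

    ∑-∘-square : (g : Carrier → ℤ) → ℤ-Sum.∑ (λ y → g (y * y)) ≡ ℤ-Sum.∑ g
    ∑-∘-square = ℤ-Sum.∑-reindex (λ y → y * y) √ √x*√x≡x √[x*x]≡x

  -- Polynomials are coefficient lists, constant term first; a monic polynomial is given
  -- by its coefficients below the leading 1. In characteristic 2 a root a splits off x + a.
  eval : List Carrier → Carrier → Carrier
  eval [] x = 0#
  eval (c ∷ cs) x = c + x * eval cs x

  evalMonic : List Carrier → Carrier → Carrier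
  evalMonic [] x = 1#
  evalMonic (c ∷ cs) x = c + x * evalMonic cs x

  evalMonic≡x^n+eval : ∀ cs x → evalMonic cs x ≡ x ^ length cs + eval cs x
  evalMonic≡x^n+eval [] x = sym (+-identityʳ 1#)
  evalMonic≡x^n+eval (c ∷ cs) x = trans (cong (λ t → c + x * t) (evalMonic≡x^n+eval cs x))
    (solve 4 (λ c x a b → c :+ x :* (a :+ b) := x :* a :+ (c :+ x :* b)) refl c x (x ^ length cs) (eval cs x))

  eval-++-zeros : ∀ cs n x → eval (cs ++ replicate n 0#) x ≡ eval cs x
  eval-++-zeros [] zero x = refl
  eval-++-zeros [] (suc n) x = trans (cong (λ t → 0# + x * t) (eval-++-zeros [] n x)) (trans (+-identityˡ _) (zeroʳ x))
  eval-++-zeros (c ∷ cs) n x = cong (λ t → c + x * t) (eval-++-zeros cs n x)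

  quotient : Carrier → List Carrier → List Carrier
  quotient a [] = []
  quotient a (c ∷ []) = []
  quotient a (c ∷ c′ ∷ cs) = evalMonic (c′ ∷ cs) a ∷ quotient a (c′ ∷ cs)

  length-quotient : ∀ a c cs → length (quotient a (c ∷ cs)) ≡ length cs
  length-quotient a c [] = refl
  length-quotient a c (c′ ∷ cs) = cong suc (length-quotient a c′ cs)

  evalMonic-quotient : ∀ a c cs x → evalMonic (c ∷ cs) x ≡ (x + a) * evalMonic (quotient a (c ∷ cs)) x + evalMonic (c ∷ cs) a
  evalMonic-quotient a c [] x = begin
      c + x * 1#                   ≡⟨ sym (trans (cong (c + x * 1# +_) (x+x≡0 a)) (+-identityʳ _)) ⟩
      c + x * 1# + (a + a)         ≡⟨ solve 3 (λ a c x → c :+ x :* con 1 :+ (a :+ a) := (x :+ a) :* con 1 :+ (c :+ a :* con 1)) refl a c x ⟩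
      (x + a) * 1# + (c + a * 1#)  ∎
    where open ≡-Reasoning
  evalMonic-quotient a c (c′ ∷ cs) x = begin
      c + x * p                                      ≡⟨ cong (λ t → c + x * t) (evalMonic-quotient a c′ cs x) ⟩
      c + x * ((x + a) * r + pa)                     ≡⟨ sym (trans (cong (c + x * ((x + a) * r + pa) +_) (x+x≡0 (a * pa))) (+-identityʳ _)) ⟩
      c + x * ((x + a) * r + pa) + (a * pa + a * pa) ≡⟨ solve 5 (λ a c x r pa → c :+ x :* ((x :+ a) :* r :+ pa) :+ (a :* pa :+ a :* pa)
                                                          := (x :+ a) :* (pa :+ x :* r) :+ (c :+ a :* pa)) refl a c x r pa ⟩
      (x + a) * (pa + x * r) + (c + a * pa)          ∎
    where
    open ≡-Reasoning
    p = evalMonic (c′ ∷ cs) x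
    pa = evalMonic (c′ ∷ cs) a
    r = evalMonic (quotient a (c′ ∷ cs)) x

  _⊕_ : List Carrier → List Carrier → List Carrier
  [] ⊕ ds = ds
  (c ∷ cs) ⊕ [] = c ∷ cs
  (c ∷ cs) ⊕ (d ∷ ds) = (c + d) ∷ (cs ⊕ ds)

  eval-⊕ : ∀ cs ds x → eval (cs ⊕ ds) x ≡ eval cs x + eval ds x
  eval-⊕ [] ds x = sym (+-identityˡ _)
  eval-⊕ (c ∷ cs) [] x = sym (+-identityʳ _)
  eval-⊕ (c ∷ cs) (d ∷ ds) x = trans (cong (λ t → (c + d) + x * t) (eval-⊕ cs ds x))
    (solve 5 (λ c d x u v → (c :+ d) :+ x :* (u :+ v) := (c :+ x :* u) :+ (d :+ x :* v)) refl c d x (eval cs x) (eval ds x))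

  length-⊕ : ∀ cs ds {n} → length cs ℕ.≤ n → length ds ℕ.≤ n → length (cs ⊕ ds) ℕ.≤ n
  length-⊕ [] ds _ ds≤n = ds≤n
  length-⊕ (c ∷ cs) [] cs≤n _ = cs≤n
  length-⊕ (c ∷ cs) (d ∷ ds) (s≤s cs≤n) (s≤s ds≤n) = s≤s (length-⊕ cs ds cs≤n ds≤n)

  monomial : ℕ → List Carrier
  monomial n = replicate n 0# ++ 1# ∷ []

  eval-monomial : ∀ n x → eval (monomial n) x ≡ x ^ n
  eval-monomial zero x = trans (cong (1# +_) (zeroʳ x)) (+-identityʳ 1#)
  eval-monomial (suc n) x = trans (+-identityˡ _) (cong (x *_) (eval-monomial n x))

  length-monomial : ∀ n → length (monomial n) ≡ suc n
  length-monomial n = trans (length-++ (replicate n 0#)) (trans (cong (ℕ._+ 1) (length-replicate n)) (ℕ.+-comm n 1))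

  roots≤degree : ∀ cs rs → Unique rs → All (λ r → evalMonic cs r ≡ 0#) rs → length rs ℕ.≤ length cs
  roots≤degree cs [] _ _ = z≤n
  roots≤degree [] (r ∷ rs) _ (1≡0 ∷ _) = contradiction 1≡0 1≢0
  roots≤degree (c ∷ cs) (a ∷ rs) (a∉rs ∷ rs-unique) (a-root ∷ rs-roots) =
    s≤s (subst (length rs ℕ.≤_) (length-quotient a c cs)
      (roots≤degree (quotient a (c ∷ cs)) rs rs-unique (All.zipWith quotient-root (a∉rs , rs-roots))))
    where
    quotient-root : ∀ {r} → ¬ a ≡ r × evalMonic (c ∷ cs) r ≡ 0# → evalMonic (quotient a (c ∷ cs)) r ≡ 0#
    quotient-root {r} (a≢r , r-root) with x*y≡0⇒x≡0⊎y≡0 (r + a) _ product≡0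
      where
      product = (r + a) * evalMonic (quotient a (c ∷ cs)) r
      product≡0 : product ≡ 0#
      product≡0 = trans (sym (+-identityʳ _)) (trans (cong (product +_) (sym a-root)) (trans (sym (evalMonic-quotient a c cs r)) r-root))
    ... | inj₁ r+a≡0 = contradiction (sym (x+y≡0⇒x≡y r+a≡0)) a≢r
    ... | inj₂ q≡0 = q≡0

  monic-nonroot : ∀ d cs → length cs ℕ.≤ d → d ℕ.< 2 ℕ.^ k → ∃ λ x → ¬ x ^ d + eval cs x ≡ 0#
  monic-nonroot d cs cs≤d d<N = counterexample (λ x → (x ^ d + eval cs x) ≟ 0#) λ all-roots →
    ℕ.<⇒≱ d<N (subst₂ ℕ._≤_ length-elements length-padded
      (roots≤degree padded elements elements-unique (All.universal (padded-root all-roots) elements)))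
    where
    padded = cs ++ replicate (d ℕ.∸ length cs) 0#
    length-padded : length padded ≡ d
    length-padded = trans (length-++ cs) (trans (cong (length cs ℕ.+_) (length-replicate _)) (ℕ.m+[n∸m]≡n cs≤d))
    padded-root : (∀ x → x ^ d + eval cs x ≡ 0#) → ∀ x → evalMonic padded x ≡ 0#
    padded-root all-roots x = trans (evalMonic≡x^n+eval padded x)
      (trans (cong₂ (λ n t → x ^ n + t) length-padded (eval-++-zeros cs _ x)) (all-roots x))

  -- A nonroot x of X^(m+2) + X gives ω = x^(m+1): then x ω³ = x^N = x while x ω ≢ x.
  primitive-cube-root-of-unity : ∀ m → 2 ℕ.^ k ≡ 4 ℕ.+ 3 ℕ.* m → ∃ λ ω → ω ^ 3 ≡ 1# × ¬ ω ≡ 1#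
  primitive-cube-root-of-unity m N≡4+3m with monic-nonroot (2 ℕ.+ m) (0# ∷ 1# ∷ []) (s≤s (s≤s z≤n)) d<N
    where
    d<N : 2 ℕ.+ m ℕ.< 2 ℕ.^ k
    d<N = subst (3 ℕ.+ m ℕ.≤_) (sym N≡4+3m) (ℕ.+-mono-≤ (ℕ.n≤1+n 3) (ℕ.m≤n*m m 3))
  ... | x , x^[2+m]+x≢0 = ω , ω³≡1 , ω≢1
    where
    ω = x ^ suc m
    x^[2+m]≢x : ¬ x ^ (2 ℕ.+ m) ≡ x
    x^[2+m]≢x eq = x^[2+m]+x≢0 (trans (cong₂ _+_ eq (solve 1 (λ x → con 0 :+ x :* (con 1 :+ x :* con 0) := x) refl x)) (x+x≡0 x))
    x≢0 : ¬ x ≡ 0#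
    x≢0 refl = x^[2+m]≢x (0^n≡0 (2 ℕ.+ m))
    ω≢1 : ¬ ω ≡ 1#
    ω≢1 ω≡1 = x^[2+m]≢x (trans (cong (x *_) ω≡1) (*-identityʳ x))
    ω³≡1 : ω ^ 3 ≡ 1#
    ω³≡1 = *-cancelˡ x x≢0 (begin
        x * ω ^ 3                 ≡⟨ cong (x *_) (sym (^-* x (suc m) 3)) ⟩
        x ^ (4 ℕ.+ m ℕ.* 3)       ≡⟨ cong (λ t → x ^ (4 ℕ.+ t)) (ℕ.*-comm m 3) ⟩
        x ^ (4 ℕ.+ 3 ℕ.* m)       ≡⟨ cong (x ^_) (sym N≡4+3m) ⟩
        x ^ (2 ℕ.^ k)             ≡⟨ x^N≡x x ⟩
        x                         ≡⟨ sym (*-identityʳ x) ⟩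
        x * 1#                    ∎)
      where open ≡-Reasoning

  module PrimitiveCubeRoot (ω : Carrier) (ω³≡1 : ω ^ 3 ≡ 1#) (ω≢1 : ¬ ω ≡ 1#) where

    ω*ω*ω≡1 : ω * ω * ω ≡ 1#
    ω*ω*ω≡1 = trans (sym (x^3≡x*x*x ω)) ω³≡1

    ω≢0 : ¬ ω ≡ 0#
    ω≢0 refl = 1≢0 (trans (sym ω³≡1) (0^n≡0 3))

    ω*ω+ω+1≡0 : ω * ω + ω + 1# ≡ 0#
    ω*ω+ω+1≡0 with x*y≡0⇒x≡0⊎y≡0 (ω + 1#) (ω * ω + ω + 1#) product≡0
      where
      open ≡-Reasoning
      product≡0 : (ω + 1#) * (ω * ω + ω + 1#) ≡ 0#
      product≡0 = begin
          (ω + 1#) * (ω * ω + ω + 1#)                        ≡⟨ solve 1 (λ w → (w :+ con 1) :* (w :* w :+ w :+ con 1)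
                                                                  := (w :* w :* w :+ con 1) :+ ((w :* w :+ w) :+ (w :* w :+ w))) refl ω ⟩
          (ω * ω * ω + 1#) + ((ω * ω + ω) + (ω * ω + ω))    ≡⟨ cong₂ _+_ (trans (cong (_+ 1#) ω*ω*ω≡1) (x+x≡0 1#)) (x+x≡0 _) ⟩
          0# + 0#                                            ≡⟨ +-identityʳ 0# ⟩
          0#                                                 ∎
    ... | inj₁ ω+1≡0 = contradiction (x+y≡0⇒x≡y ω+1≡0) ω≢1
    ... | inj₂ ω*ω+ω+1≡0 = ω*ω+ω+1≡0

    𝔽₄ : List Carrier
    𝔽₄ = 0# ∷ 1# ∷ ω ∷ ω * ω ∷ []

    𝔽₄-unique : Unique 𝔽₄
    𝔽₄-unique = (0≢1 ∷ (ω≢0 ∘ sym) ∷ (*-nonzero ω≢0 ω≢0 ∘ sym) ∷ [])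
              ∷ ((ω≢1 ∘ sym) ∷ 1≢ω*ω ∷ [])
              ∷ (ω≢ω*ω ∷ [])
              ∷ [] ∷ []
      where
      1≢ω*ω : ¬ 1# ≡ ω * ω
      1≢ω*ω 1≡ω*ω = ω≢1 (trans (sym (*-identityˡ ω)) (trans (cong (_* ω) 1≡ω*ω) ω*ω*ω≡1))
      ω≢ω*ω : ¬ ω ≡ ω * ω
      ω≢ω*ω ω≡ω*ω = ω≢1 (sym (*-cancelˡ ω ω≢0 (trans (*-identityʳ ω) ω≡ω*ω)))

    x^4≡x⇔x∈𝔽₄ : ∀ x → x ^ 4 ≡ x ⇔ x ∈ 𝔽₄
    x^4≡x⇔x∈𝔽₄ x = mk⇔ to from
      where
      open ≡-Reasoning
      factorisation : x * (x + 1#) * (x + ω) * (x + ω * ω) ≡ x ^ 4 + x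
      factorisation = begin
          x * (x + 1#) * (x + ω) * (x + ω * ω)
            ≡⟨ solve 2 (λ x w → x :* (x :+ con 1) :* (x :+ w) :* (x :+ w :* w)
                 := x :* (x :* (x :* (x :* con 1))) :+ (w :* w :+ w :+ con 1) :* (x :* x :* x)
                    :+ w :* (w :* w :+ w :+ con 1) :* (x :* x) :+ w :* w :* w :* x) refl x ω ⟩
          x ^ 4 + (ω * ω + ω + 1#) * (x * x * x) + ω * (ω * ω + ω + 1#) * (x * x) + ω * ω * ω * x
            ≡⟨ cong₂ (λ s c → x ^ 4 + s * (x * x * x) + ω * s * (x * x) + c * x) ω*ω+ω+1≡0 ω*ω*ω≡1 ⟩
          x ^ 4 + 0# * (x * x * x) + ω * 0# * (x * x) + 1# * x
            ≡⟨ solve 5 (λ a b c w y → a :+ con 0 :* b :+ w :* con 0 :* c :+ con 1 :* y := a :+ y) refl (x ^ 4) (x * x * x) (x * x) ω x ⟩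
          x ^ 4 + x ∎
      to : x ^ 4 ≡ x → x ∈ 𝔽₄
      to x^4≡x with x*y≡0⇒x≡0⊎y≡0 _ _ (trans factorisation (trans (cong (_+ x) x^4≡x) (x+x≡0 x)))
      ... | inj₂ x+ω*ω≡0 = there (there (there (here (x+y≡0⇒x≡y x+ω*ω≡0))))
      ... | inj₁ x[x+1][x+ω]≡0 with x*y≡0⇒x≡0⊎y≡0 _ _ x[x+1][x+ω]≡0
      ...   | inj₂ x+ω≡0 = there (there (here (x+y≡0⇒x≡y x+ω≡0)))
      ...   | inj₁ x[x+1]≡0 with x*y≡0⇒x≡0⊎y≡0 _ _ x[x+1]≡0
      ...     | inj₁ x≡0 = here x≡0
      ...     | inj₂ x+1≡0 = there (here (x+y≡0⇒x≡y x+1≡0))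
      ω^4≡ω : ω ^ 4 ≡ ω
      ω^4≡ω = trans (cong (ω *_) ω³≡1) (*-identityʳ ω)
      from : x ∈ 𝔽₄ → x ^ 4 ≡ x
      from (here refl) = 0^n≡0 4
      from (there (here refl)) = 1^n≡1 4
      from (there (there (here refl))) = ω^4≡ω
      from (there (there (there (here refl)))) = trans (*-^ ω ω 4) (cong₂ _*_ ω^4≡ω ω^4≡ω)

module Trace (e : ℕ) (F : FiniteField (2 ℕ.^ (2 ℕ.* e))) where

  open CharacteristicTwo {2 ℕ.* e} F public
  open FieldDefs e F public

  N : ℕ
  N = 2 ℕ.^ (2 ℕ.* e)

  -- Tr is tr (2e), and tr e is the trace from F_{q²} to F_q.
  tr : ℕ → Carrier → Carrier
  tr zero x = 0#
  tr (suc j) x = tr j x + x ^ (2 ℕ.^ j)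

  Tr≡tr : ∀ x → Tr x ≡ tr (2 ℕ.* e) x
  Tr≡tr x = foldr≡tr (2 ℕ.* e)
    where
    term : ℕ → Carrier → Carrier
    term i acc = x ^ (2 ℕ.^ i) + acc
    foldr-+ : ∀ z is → foldr term z is ≡ foldr term 0# is + z
    foldr-+ z [] = sym (+-identityˡ z)
    foldr-+ z (i ∷ is) = trans (cong (x ^ (2 ℕ.^ i) +_) (foldr-+ z is)) (sym (+-assoc _ _ _))
    foldr≡tr : ∀ n → foldr term 0# (upTo n) ≡ tr n x
    foldr≡tr zero = refl
    foldr≡tr (suc n) = begin
        foldr term 0# (upTo (suc n))        ≡⟨ cong (foldr term 0#) (sym (applyUpTo-∷ʳ id n)) ⟩
        foldr term 0# (upTo n ∷ʳ n)         ≡⟨ foldr-∷ʳ term 0# n (upTo n) ⟩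
        foldr term (term n 0#) (upTo n)     ≡⟨ foldr-+ (term n 0#) (upTo n) ⟩
        foldr term 0# (upTo n) + term n 0#  ≡⟨ cong₂ _+_ (foldr≡tr n) (+-identityʳ _) ⟩
        tr (suc n) x                        ∎
      where open ≡-Reasoning

  tr-+ : ∀ j x y → tr j (x + y) ≡ tr j x + tr j y
  tr-+ zero x y = sym (+-identityˡ 0#)
  tr-+ (suc j) x y = trans (cong₂ _+_ (tr-+ j x y) (frobenius j x y))
    (solve 4 (λ a b c d → (a :+ b) :+ (c :+ d) := (a :+ c) :+ (b :+ d)) refl _ _ _ _)

  tr-0 : ∀ j → tr j 0# ≡ 0#
  tr-0 zero = refl
  tr-0 (suc j) = trans (cong₂ _+_ (tr-0 j) (0^n≡0 (2 ℕ.^ j) {{ℕ.m^n≢0 2 j}})) (+-identityˡ 0#)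

  tr-square : ∀ j x → tr j x * tr j x ≡ tr j (x * x)
  tr-square zero x = zeroˡ 0#
  tr-square (suc j) x = begin
      (tr j x + x ^ (2 ℕ.^ j)) * (tr j x + x ^ (2 ℕ.^ j))  ≡⟨ square-+ _ _ ⟩
      tr j x * tr j x + x ^ (2 ℕ.^ j) * x ^ (2 ℕ.^ j)      ≡⟨ cong₂ _+_ (tr-square j x) (trans (sym (x^[2^[1+j]]≡[x^[2^j]]² j x)) (x^[2^[1+j]]≡[x*x]^[2^j] j x)) ⟩
      tr j (x * x) + (x * x) ^ (2 ℕ.^ j)                   ∎
    where open ≡-Reasoning

  tr-suc : ∀ j x → tr (suc j) x ≡ x + tr j (x * x)
  tr-suc zero x = trans (+-identityˡ _) (trans (x^1≡x x) (sym (+-identityʳ x)))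
  tr-suc (suc j) x = begin
      tr (suc j) x + x ^ (2 ℕ.^ suc j)           ≡⟨ cong₂ _+_ (tr-suc j x) (x^[2^[1+j]]≡[x*x]^[2^j] j x) ⟩
      (x + tr j (x * x)) + (x * x) ^ (2 ℕ.^ j)   ≡⟨ +-assoc _ _ _ ⟩
      x + tr (suc j) (x * x)                     ∎
    where open ≡-Reasoning

  tr-+-length : ∀ i j x → tr (i ℕ.+ j) x ≡ tr i x + tr j (x ^ (2 ℕ.^ i))
  tr-+-length i zero x = trans (cong (λ n → tr n x) (ℕ.+-identityʳ i)) (sym (+-identityʳ _))
  tr-+-length i (suc j) x = begin
      tr (i ℕ.+ suc j) x                       ≡⟨ cong (λ n → tr n x) (ℕ.+-suc i j) ⟩
      tr (i ℕ.+ j) x + x ^ (2 ℕ.^ (i ℕ.+ j))   ≡⟨ cong₂ _+_ (tr-+-length i j x) (trans (cong (x ^_) (ℕ.^-distribˡ-+-* 2 i j)) (^-* x (2 ℕ.^ i) (2 ℕ.^ j))) ⟩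
      (tr i x + tr j y) + y ^ (2 ℕ.^ j)        ≡⟨ +-assoc _ _ _ ⟩
      tr i x + tr (suc j) y                    ∎
    where
    open ≡-Reasoning
    y = x ^ (2 ℕ.^ i)

  Tr-+ : ∀ x y → Tr (x + y) ≡ Tr x + Tr y
  Tr-+ x y = trans (Tr≡tr _) (trans (tr-+ (2 ℕ.* e) x y) (sym (cong₂ _+_ (Tr≡tr x) (Tr≡tr y))))

  -- Both sides are read off tr (2e + 1) x = x + tr (2e) (x * x) = tr (2e) x + x ^ N.
  Tr-square : ∀ x → Tr (x * x) ≡ Tr x
  Tr-square x = begin
      Tr (x * x)    ≡⟨ Tr≡tr (x * x) ⟩
      tr n (x * x)  ≡⟨ +-cancelˡ x _ _ shift ⟩
      tr n x        ≡⟨ sym (Tr≡tr x) ⟩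
      Tr x          ∎
    where
    open ≡-Reasoning
    n = 2 ℕ.* e
    shift : x + tr n (x * x) ≡ x + tr n x
    shift = begin
        x + tr n (x * x)        ≡⟨ sym (tr-suc n x) ⟩
        tr n x + x ^ N          ≡⟨ cong (tr n x +_) (x^N≡x x) ⟩
        tr n x + x              ≡⟨ +-comm _ x ⟩
        x + tr n x              ∎

  Tr∈𝔽₂ : ∀ x → Tr x ≡ 0# ⊎ Tr x ≡ 1#
  Tr∈𝔽₂ x with Tr x ≟ 0#
  ... | yes Tr≡0 = inj₁ Tr≡0
  ... | no Tr≢0 = inj₂ (*-cancelˡ (Tr x) Tr≢0 (trans idempotent (sym (*-identityʳ (Tr x)))))
    where
    idempotent : Tr x * Tr x ≡ Tr x
    idempotent = trans (cong₂ _*_ (Tr≡tr x) (Tr≡tr x)) (trans (tr-square (2 ℕ.* e) x) (trans (sym (Tr≡tr _)) (Tr-square x)))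

  Tr-^q : ∀ x → Tr (x ^ q) ≡ Tr x
  Tr-^q = Tr-^2^ e
    where
    Tr-^2^ : ∀ j x → Tr (x ^ (2 ℕ.^ j)) ≡ Tr x
    Tr-^2^ zero x = cong Tr (x^1≡x x)
    Tr-^2^ (suc j) x = trans (cong Tr (x^[2^[1+j]]≡[x^[2^j]]² j x)) (trans (Tr-square _) (Tr-^2^ j x))

  2e≡e+e : 2 ℕ.* e ≡ e ℕ.+ e
  2e≡e+e = cong (e ℕ.+_) (ℕ.+-identityʳ e)

  q*q≡N : q ℕ.* q ≡ N
  q*q≡N = trans (sym (ℕ.^-distribˡ-+-* 2 e e)) (cong (2 ℕ.^_) (sym 2e≡e+e))

  +N≡+q*+q : ℤ.+ N ≡ ℤ.+ q ℤ.* ℤ.+ q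
  +N≡+q*+q = trans (cong ℤ.+_ (sym q*q≡N)) (ℤ.pos-* q q)

  [x^q]^q≡x : ∀ x → (x ^ q) ^ q ≡ x
  [x^q]^q≡x x = trans (sym (^-* x q q)) (trans (cong (x ^_) q*q≡N) (x^N≡x x))

  Tr≡tr[x+x^q] : ∀ x → Tr x ≡ tr e (x + x ^ q)
  Tr≡tr[x+x^q] x = trans (Tr≡tr x) (trans (cong (λ n → tr n x) 2e≡e+e) (trans (tr-+-length e e x) (sym (tr-+ e x _))))

  InFq-0 : InFq 0#
  InFq-0 = 0^n≡0 q {{ℕ.m^n≢0 2 e}}

  InFq-1 : InFq 1#
  InFq-1 = 1^n≡1 q

  InFq-+ : ∀ {x y} → InFq x → InFq y → InFq (x + y)
  InFq-+ {x} {y} x∈Fq y∈Fq = trans (frobenius e x y) (cong₂ _+_ x∈Fq y∈Fq)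

  InFq-* : ∀ {x y} → InFq x → InFq y → InFq (x * y)
  InFq-* {x} {y} x∈Fq y∈Fq = trans (*-^ x y q) (cong₂ _*_ x∈Fq y∈Fq)

  InFq-inv : ∀ {x} (x≢0 : ¬ x ≡ 0#) → InFq x → InFq (inv x x≢0)
  InFq-inv {x} x≢0 x∈Fq = *-cancelˡ x x≢0 (begin
      x * inv x x≢0 ^ q       ≡⟨ cong (_* (inv x x≢0 ^ q)) (sym x∈Fq) ⟩
      x ^ q * inv x x≢0 ^ q   ≡⟨ sym (*-^ x _ q) ⟩
      (x * inv x x≢0) ^ q     ≡⟨ cong (_^ q) (x*inv≡1 x x≢0) ⟩
      1# ^ q                  ≡⟨ 1^n≡1 q ⟩
      1#                      ≡⟨ sym (x*inv≡1 x x≢0) ⟩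
      x * inv x x≢0           ∎)
    where open ≡-Reasoning

  InFq-x+x^q : ∀ x → InFq (x + x ^ q)
  InFq-x+x^q x = trans (frobenius e x (x ^ q)) (trans (cong (x ^ q +_) ([x^q]^q≡x x)) (+-comm _ _))

  Tr-Fq : ∀ {x} → InFq x → Tr x ≡ 0#
  Tr-Fq {x} x∈Fq = trans (Tr≡tr[x+x^q] x) (trans (cong (λ t → tr e (x + t)) x∈Fq) (trans (cong (tr e) (x+x≡0 x)) (tr-0 e)))

  trPolynomial : ℕ → List Carrier
  trPolynomial zero = []
  trPolynomial (suc j) = trPolynomial j ⊕ monomial (2 ℕ.^ j)

  eval-trPolynomial : ∀ j x → eval (trPolynomial j) x ≡ tr j x
  eval-trPolynomial zero x = refl
  eval-trPolynomial (suc j) x = trans (eval-⊕ (trPolynomial j) _ x) (cong₂ _+_ (eval-trPolynomial j x) (eval-monomial (2 ℕ.^ j) x))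

  length-trPolynomial : ∀ j → length (trPolynomial j) ℕ.≤ 2 ℕ.^ j
  length-trPolynomial zero = z≤n
  length-trPolynomial (suc j) = length-⊕ (trPolynomial j) (monomial (2 ℕ.^ j))
    (ℕ.≤-trans (length-trPolynomial j) (ℕ.m≤m+n (2 ℕ.^ j) _))
    (subst (ℕ._≤ 2 ℕ.^ suc j) (sym (length-monomial _)) (ℕ.^-monoʳ-< 2 (s≤s (s≤s z≤n)) (ℕ.n<1+n j)))

  -- Tr is a polynomial of degree 2^(2e-1) < N, so it does not vanish everywhere.
  ∃Tr≡1 : .{{NonZero e}} → ∃ λ t → Tr t ≡ 1#
  ∃Tr≡1 = nonzero-trace (ℕ.pred (2 ℕ.* e)) (sym (ℕ.suc-pred (2 ℕ.* e) {{ℕ.m*n≢0 2 e}}))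
    where
    nonzero-trace : ∀ j → 2 ℕ.* e ≡ suc j → ∃ λ t → Tr t ≡ 1#
    nonzero-trace j 2e≡1+j with monic-nonroot (2 ℕ.^ j) (trPolynomial j) (length-trPolynomial j)
                                  (subst (2 ℕ.^ j ℕ.<_) (cong (2 ℕ.^_) (sym 2e≡1+j)) (ℕ.^-monoʳ-< 2 (s≤s (s≤s z≤n)) (ℕ.n<1+n j)))
    ... | t , t-nonroot with Tr∈𝔽₂ t
    ...   | inj₂ Tr≡1 = t , Tr≡1
    ...   | inj₁ Tr≡0 = contradiction Tr-as-polynomial t-nonroot
      where
      Tr-as-polynomial : t ^ (2 ℕ.^ j) + eval (trPolynomial j) t ≡ 0#
      Tr-as-polynomial = trans (+-comm _ _) (trans (cong (_+ t ^ (2 ℕ.^ j)) (eval-trPolynomial j t))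
                           (trans (sym (cong (λ n → tr n t) 2e≡1+j)) (trans (sym (Tr≡tr t)) Tr≡0)))

  χ : Carrier → ℤ
  χ x = sign (Tr x)

  sign-0 : sign 0# ≡ 1ℤ
  sign-0 with 0# ≟ 0#
  ... | yes _ = refl
  ... | no 0≢0 = contradiction refl 0≢0

  sign-1 : sign 1# ≡ -1ℤ
  sign-1 with 1# ≟ 0#
  ... | yes 1≡0 = contradiction 1≡0 1≢0
  ... | no _ = refl

  χ-Tr≡0 : ∀ {x} → Tr x ≡ 0# → χ x ≡ 1ℤ
  χ-Tr≡0 Tr≡0 = trans (cong sign Tr≡0) sign-0

  χ-Tr≡1 : ∀ {x} → Tr x ≡ 1# → χ x ≡ -1ℤ
  χ-Tr≡1 Tr≡1 = trans (cong sign Tr≡1) sign-1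

  χ-Fq : ∀ {x} → InFq x → χ x ≡ 1ℤ
  χ-Fq = χ-Tr≡0 ∘ Tr-Fq

  χ-+ : ∀ x y → χ (x + y) ≡ χ x ℤ.* χ y
  χ-+ x y = trans (cong sign (Tr-+ x y)) (sign-+ (Tr∈𝔽₂ x) (Tr∈𝔽₂ y))
    where
    sign-+ : ∀ {a b} → a ≡ 0# ⊎ a ≡ 1# → b ≡ 0# ⊎ b ≡ 1# → sign (a + b) ≡ sign a ℤ.* sign b
    sign-+ (inj₁ refl) (inj₁ refl) rewrite +-identityˡ 0# | sign-0 = refl
    sign-+ (inj₁ refl) (inj₂ refl) rewrite +-identityˡ 1# | sign-0 | sign-1 = refl
    sign-+ (inj₂ refl) (inj₁ refl) rewrite +-identityʳ 1# | sign-0 | sign-1 = refl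
    sign-+ (inj₂ refl) (inj₂ refl) rewrite 1+1≡0 | sign-0 | sign-1 = refl

  χ*χ≡1 : ∀ x → χ x ℤ.* χ x ≡ 1ℤ
  χ*χ≡1 x with Tr∈𝔽₂ x
  ... | inj₁ Tr≡0 rewrite χ-Tr≡0 Tr≡0 = refl
  ... | inj₂ Tr≡1 rewrite χ-Tr≡1 Tr≡1 = refl

  χ-square : ∀ x → χ (x * x) ≡ χ x
  χ-square x = cong sign (Tr-square x)

  χ-^q : ∀ x → χ (x ^ q) ≡ χ x
  χ-^q x = cong sign (Tr-^q x)

  open ℤ-Sum using (∑; ∑-cong; ∑-*ˡ; ∑-*ʳ; 𝟙; 𝟙-yes; 𝟙-no; 𝟙-cong; 𝟙*f≡𝟙)

  InFq? : ∀ x → Dec (InFq x)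
  InFq? x = (x ^ q) ≟ x

  𝟙Fq : Carrier → ℤ
  𝟙Fq x = 𝟙 (InFq? x)

  ∑Fq : (Carrier → ℤ) → ℤ
  ∑Fq f = ∑ (λ x → 𝟙Fq x ℤ.* f x)

  module _ .{{_ : NonZero e}} where

    ∑χ : ∀ c → ∑ (λ y → χ (y * c)) ≡ ℤ.+ N ℤ.* 𝟙 (c ≟ 0#)
    ∑χ c with c ≟ 0#
    ... | yes refl = trans (∑-cong (λ y → trans (cong χ (zeroʳ y)) (χ-Fq InFq-0))) (trans ℤ-Sum.∑-one (sym (ℤ.*-identityʳ _)))
    ... | no c≢0 = trans (ℤ-Sum.∑-antisymmetric (_+ δ) (λ y → [x+y]+y≡x y δ) _ translate) (sym (ℤ.*-zeroʳ (ℤ.+ N)))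
      where
      t = proj₁ ∃Tr≡1
      δ = t * inv c c≢0
      translate : ∀ y → χ ((y + δ) * c) ≡ ℤ.- χ (y * c)
      translate y = begin
          χ ((y + δ) * c)             ≡⟨ cong χ (distribʳ c y δ) ⟩
          χ (y * c + δ * c)           ≡⟨ χ-+ _ _ ⟩
          χ (y * c) ℤ.* χ (δ * c)     ≡⟨ cong (χ (y * c) ℤ.*_) (χ-Tr≡1 (trans (cong Tr (x*inv[y]*y≡x t c≢0)) (proj₂ ∃Tr≡1))) ⟩
          χ (y * c) ℤ.* -1ℤ           ≡⟨ ℤ.*-comm _ -1ℤ ⟩
          -1ℤ ℤ.* χ (y * c)           ≡⟨ ℤ.-1*i≡-i _ ⟩
          ℤ.- χ (y * c)               ∎
        where open ≡-Reasoning

    -- For y ∉ F_q, translating β by δ = (t + t^q) / (y + y^q) ∈ F_q, where Tr t = 1,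
    -- flips every term, as Tr (δ y) = tr e (δ (y + y^q)) = Tr t.
    ∑Fq-χ : ∀ y → ∑Fq (λ β → χ (β * y)) ≡ ∑ 𝟙Fq ℤ.* 𝟙Fq y
    ∑Fq-χ y with InFq? y
    ... | yes y∈Fq = trans (∑-cong (λ β → 𝟙*f≡𝟙 (InFq? β) (λ β∈Fq → χ-Fq (InFq-* β∈Fq y∈Fq)))) (sym (ℤ.*-identityʳ _))
    ... | no y∉Fq = trans (ℤ-Sum.∑-antisymmetric (_+ δ) (λ β → [x+y]+y≡x β δ) _ translate) (sym (ℤ.*-zeroʳ (∑ 𝟙Fq)))
      where
      open ≡-Reasoning
      t = proj₁ ∃Tr≡1
      c = y + y ^ q
      c≢0 : ¬ c ≡ 0#
      c≢0 c≡0 = y∉Fq (sym (x+y≡0⇒x≡y c≡0))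
      δ = (t + t ^ q) * inv c c≢0
      δ∈Fq : InFq δ
      δ∈Fq = InFq-* (InFq-x+x^q t) (InFq-inv c≢0 (InFq-x+x^q y))
      Tr[δ*y]≡1 : Tr (δ * y) ≡ 1#
      Tr[δ*y]≡1 = begin
          Tr (δ * y)                   ≡⟨ Tr≡tr[x+x^q] _ ⟩
          tr e (δ * y + (δ * y) ^ q)   ≡⟨ cong (λ z → tr e (δ * y + z)) (trans (*-^ δ y q) (cong (_* (y ^ q)) δ∈Fq)) ⟩
          tr e (δ * y + δ * y ^ q)     ≡⟨ cong (tr e) (sym (distribˡ δ y (y ^ q))) ⟩
          tr e (δ * c)                 ≡⟨ cong (tr e) (x*inv[y]*y≡x (t + t ^ q) c≢0) ⟩
          tr e (t + t ^ q)             ≡⟨ sym (Tr≡tr[x+x^q] t) ⟩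
          Tr t                         ≡⟨ proj₂ ∃Tr≡1 ⟩
          1#                           ∎
      β+δ∈Fq⇔β∈Fq : ∀ β → InFq (β + δ) ⇔ InFq β
      β+δ∈Fq⇔β∈Fq β = mk⇔ (λ β+δ∈Fq → subst InFq ([x+y]+y≡x β δ) (InFq-+ β+δ∈Fq δ∈Fq)) (λ β∈Fq → InFq-+ β∈Fq δ∈Fq)
      translate : ∀ β → 𝟙Fq (β + δ) ℤ.* χ ((β + δ) * y) ≡ ℤ.- (𝟙Fq β ℤ.* χ (β * y))
      translate β = begin
          𝟙Fq (β + δ) ℤ.* χ ((β + δ) * y)       ≡⟨ cong₂ ℤ._*_ (𝟙-cong (β+δ∈Fq⇔β∈Fq β) (InFq? (β + δ)) (InFq? β)) (trans (cong χ (distribʳ y β δ)) (χ-+ _ _)) ⟩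
          𝟙Fq β ℤ.* (χ (β * y) ℤ.* χ (δ * y))   ≡⟨ cong (λ s → 𝟙Fq β ℤ.* (χ (β * y) ℤ.* s)) (χ-Tr≡1 Tr[δ*y]≡1) ⟩
          𝟙Fq β ℤ.* (χ (β * y) ℤ.* -1ℤ)         ≡⟨ negate (𝟙Fq β) (χ (β * y)) ⟩
          ℤ.- (𝟙Fq β ℤ.* χ (β * y))             ∎
        where
        negate : ∀ a b → a ℤ.* (b ℤ.* -1ℤ) ≡ ℤ.- (a ℤ.* b)
        negate = solve-∀

    -- The size m of F_q is found from m² = Σ_y Σ_{β ∈ F_q} χ (β y) = N.
    ∑𝟙Fq≡q : ∑ 𝟙Fq ≡ ℤ.+ q
    ∑𝟙Fq≡q = nonneg-square-root q (ℤ-Sum.∑-closed (0ℤ ℤ.≤_) ℤ.≤-refl ℤ.+-mono-≤ 𝟙Fq (ℤ-Sum.0≤𝟙 ∘ _)) (begin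
        m ℤ.* m                                         ≡⟨ sym (∑-*ˡ m 𝟙Fq) ⟩
        ∑ (λ y → m ℤ.* 𝟙Fq y)                           ≡⟨ ∑-cong (sym ∘ ∑Fq-χ) ⟩
        ∑ (λ y → ∑ (λ β → 𝟙Fq β ℤ.* χ (β * y)))         ≡⟨ ℤ-Sum.∑-comm (λ y β → 𝟙Fq β ℤ.* χ (β * y)) ⟩
        ∑ (λ β → ∑ (λ y → 𝟙Fq β ℤ.* χ (β * y)))         ≡⟨ ∑-cong (λ β → trans (∑-*ˡ (𝟙Fq β) (λ y → χ (β * y))) (cong (𝟙Fq β ℤ.*_) (trans (∑-cong (λ y → cong χ (*-comm β y))) (∑χ β)))) ⟩
        ∑ (λ β → 𝟙Fq β ℤ.* (ℤ.+ N ℤ.* 𝟙 (β ≟ 0#)))      ≡⟨ ℤ-Sum.∑-single (λ β → 𝟙Fq β ℤ.* (ℤ.+ N ℤ.* 𝟙 (β ≟ 0#))) 0# (λ β β≢0 → trans (cong (λ i → 𝟙Fq β ℤ.* (ℤ.+ N ℤ.* i)) (𝟙-no β≢0 (β ≟ 0#))) (trans (cong (𝟙Fq β ℤ.*_) (ℤ.*-zeroʳ (ℤ.+ N))) (ℤ.*-zeroʳ (𝟙Fq β)))) ⟩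
        𝟙Fq 0# ℤ.* (ℤ.+ N ℤ.* 𝟙 (0# ≟ 0#))            ≡⟨ cong₂ (λ i j → i ℤ.* (ℤ.+ N ℤ.* j)) (𝟙-yes InFq-0 (InFq? 0#)) (𝟙-yes refl (0# ≟ 0#)) ⟩
        1ℤ ℤ.* (ℤ.+ N ℤ.* 1ℤ)                          ≡⟨ trans (ℤ.*-identityˡ _) (ℤ.*-identityʳ _) ⟩
        ℤ.+ N                                           ≡⟨ +N≡+q*+q ⟩
        ℤ.+ q ℤ.* ℤ.+ q                                 ∎)
      where
      open ≡-Reasoning
      m = ∑ 𝟙Fq

    ∑Fq-const : ∀ c → ∑Fq (λ _ → c) ≡ ℤ.+ q ℤ.* c
    ∑Fq-const c = trans (∑-*ʳ c 𝟙Fq) (cong (ℤ._* c) ∑𝟙Fq≡q)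

    ∑Fq-difference : ∀ f c → ∑ (λ β → 𝟙Fq β ℤ.* (c ℤ.- f β)) ≡ ℤ.+ q ℤ.* c ℤ.- ∑Fq f
    ∑Fq-difference f c = begin
        ∑ (λ β → 𝟙Fq β ℤ.* (c ℤ.- f β))                     ≡⟨ ∑-cong (λ β → expand (𝟙Fq β) c (f β)) ⟩
        ∑ (λ β → 𝟙Fq β ℤ.* c ℤ.+ -1ℤ ℤ.* (𝟙Fq β ℤ.* f β))    ≡⟨ ℤ-Sum.∑-distrib (λ β → 𝟙Fq β ℤ.* c) (λ β → -1ℤ ℤ.* (𝟙Fq β ℤ.* f β)) ⟩
        ∑Fq (λ _ → c) ℤ.+ ∑ (λ β → -1ℤ ℤ.* (𝟙Fq β ℤ.* f β)) ≡⟨ cong₂ ℤ._+_ (∑Fq-const c) (trans (∑-*ˡ -1ℤ (λ β → 𝟙Fq β ℤ.* f β)) (ℤ.-1*i≡-i (∑Fq f))) ⟩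
        ℤ.+ q ℤ.* c ℤ.- ∑Fq f                              ∎
      where
      open ≡-Reasoning
      expand : ∀ i c x → i ℤ.* (c ℤ.- x) ≡ i ℤ.* c ℤ.+ -1ℤ ℤ.* (i ℤ.* x)
      expand = solve-∀

    ∑Fq≢⇒∃≢ : ∀ f c → ¬ ∑Fq f ≡ ℤ.+ q ℤ.* c → ∃ λ β → InFq β × ¬ f β ≡ c
    ∑Fq≢⇒∃≢ f c ∑Fq≢ with ℤ-Sum.∑≢0⇒∃≢0 (λ β → 𝟙Fq β ℤ.* (c ℤ.- f β)) (λ ∑≡0 → ∑Fq≢ (sym (ℤ.i-j≡0⇒i≡j _ _ (trans (sym (∑Fq-difference f c)) ∑≡0))))
    ... | β , term≢0 with InFq? β
    ...   | yes β∈Fq = β , β∈Fq , λ fβ≡c → term≢0 (trans (cong (λ x → 1ℤ ℤ.* (c ℤ.- x)) fβ≡c) (cong (1ℤ ℤ.*_) (ℤ.+-inverseʳ c)))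
    ...   | no _ = contradiction refl term≢0

    ∑Fq-maximal : ∀ f c → (∀ {β} → InFq β → f β ℤ.≤ c) → ∑Fq f ≡ ℤ.+ q ℤ.* c → ∀ {β} → InFq β → f β ≡ c
    ∑Fq-maximal f c f≤c ∑Fq≡ {β} β∈Fq = sym (ℤ.i-j≡0⇒i≡j c (f β) (trans (sym (𝟙*f≡𝟙′)) (ℤ-Sum.∑-nonneg-≡0 (λ β → 𝟙Fq β ℤ.* (c ℤ.- f β)) nonneg ∑≡0 β)))
      where
      nonneg : ∀ β → 0ℤ ℤ.≤ 𝟙Fq β ℤ.* (c ℤ.- f β)
      nonneg β with InFq? β
      ... | yes β∈Fq = subst (0ℤ ℤ.≤_) (sym (ℤ.*-identityˡ _)) (ℤ.i≤j⇒0≤j-i (f≤c β∈Fq))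
      ... | no _ = ℤ.≤-refl
      ∑≡0 : ∑ (λ β → 𝟙Fq β ℤ.* (c ℤ.- f β)) ≡ 0ℤ
      ∑≡0 = trans (∑Fq-difference f c) (trans (cong (ℤ._-_ (ℤ.+ q ℤ.* c)) ∑Fq≡) (ℤ.+-inverseʳ (ℤ.+ q ℤ.* c)))
      𝟙*f≡𝟙′ : 𝟙Fq β ℤ.* (c ℤ.- f β) ≡ c ℤ.- f β
      𝟙*f≡𝟙′ = trans (cong (ℤ._* (c ℤ.- f β)) (𝟙-yes β∈Fq (InFq? β))) (ℤ.*-identityˡ _)

    q*q≢q*c : ∀ c → ℤ.∣ c ∣ ≡ 2 ℕ.* q → ¬ ℤ.+ q ℤ.* ℤ.+ q ≡ ℤ.+ q ℤ.* c
    q*q≢q*c c ∣c∣≡2q q*q≡q*c = ℕ.<-irrefl (trans (cong ℤ.∣_∣ (ℤ.*-cancelˡ-≡ (ℤ.+ q) (ℤ.+ q) c {{ℕ.m^n≢0 2 e}} q*q≡q*c)) ∣c∣≡2q)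
                                             (ℕ.m<m+n q (subst (0 ℕ.<_) (sym (ℕ.+-identityʳ q)) (ℕ.m^n>0 2 e)))

4^e≡4+3m : ∀ e → .{{NonZero e}} → ∃ λ m → 2 ℕ.^ (2 ℕ.* e) ≡ 4 ℕ.+ 3 ℕ.* m
4^e≡4+3m (suc zero) = 0 , refl
4^e≡4+3m (suc (suc e)) with 4^e≡4+3m (suc e)
... | m , 4^[1+e]≡4+3m = 4 ℕ.* m ℕ.+ 4 , (begin
    2 ℕ.^ (2 ℕ.* suc (suc e))        ≡⟨ cong (2 ℕ.^_) (ℕ.*-suc 2 (suc e)) ⟩
    2 ℕ.^ (2 ℕ.+ 2 ℕ.* suc e)        ≡⟨ ℕ.^-distribˡ-+-* 2 2 (2 ℕ.* suc e) ⟩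
    4 ℕ.* 2 ℕ.^ (2 ℕ.* suc e)        ≡⟨ cong (4 ℕ.*_) 4^[1+e]≡4+3m ⟩
    4 ℕ.* (4 ℕ.+ 3 ℕ.* m)            ≡⟨ +-*-Solver.solve 1 (λ m → con 4 :* (con 4 :+ con 3 :* m) := con 4 :+ con 3 :* (con 4 :* m :+ con 4)) refl m ⟩
    4 ℕ.+ 3 ℕ.* (4 ℕ.* m ℕ.+ 4)      ∎)
  where
  open ≡-Reasoning
  open +-*-Solver using (con; _:*_; _:+_; _:=_)

module CubicSum (e : ℕ) .{{_ : NonZero e}} (F : FiniteField (2 ℕ.^ (2 ℕ.* e))) where

  open Trace e F public
  open ℤ-Sum using (∑; ∑-cong; ∑-*ˡ; ∑-*ʳ; ∑-comm; 𝟙; 𝟙-cong; 𝟙*f≡𝟙)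
  open DecMembership _≟_ using (_∈?_)

  private
    instance
      2e-nonZero : NonZero (2 ℕ.* e)
      2e-nonZero = ℕ.m*n≢0 2 e

  cubic : Carrier → Carrier → Carrier → Carrier
  cubic α β y = α * (y * y * y) + β * y

  shiftCoefficient : Carrier → Carrier → Carrier
  shiftCoefficient α a = α * a + α * α * (a * a * a * a)

  cubicSum : Carrier → Carrier → ℤ
  cubicSum α β = ∑ (λ y → χ (cubic α β y))

  -- cubic y + cubic (y + a) = u + w + cubic a with u = α y² a, w = α y a²,
  -- and u + w² = y² · shiftCoefficient a, while χ w = χ (w * w).
  χ-cubic-shift : ∀ α β y a → χ (cubic α β y) ℤ.* χ (cubic α β (y + a)) ≡ χ (cubic α β a) ℤ.* χ (y * y * shiftCoefficient α a)
  χ-cubic-shift α β y a = begin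
      χ (cubic α β y) ℤ.* χ (cubic α β (y + a))   ≡⟨ sym (χ-+ _ _) ⟩
      χ (cubic α β y + cubic α β (y + a))         ≡⟨ cong χ difference ⟩
      χ ((u + w) + cubic α β a)                   ≡⟨ χ-+ _ _ ⟩
      χ (u + w) ℤ.* χ (cubic α β a)               ≡⟨ cong (ℤ._* χ (cubic α β a)) (trans (χ-+ u w) (trans (cong (χ u ℤ.*_) (sym (χ-square w))) (sym (χ-+ u (w * w))))) ⟩
      χ (u + w * w) ℤ.* χ (cubic α β a)           ≡⟨ cong (λ z → χ z ℤ.* χ (cubic α β a)) (solve 3 (λ α y a → α :* (y :* y :* a) :+ (α :* (y :* a :* a)) :* (α :* (y :* a :* a))
                                                        := y :* y :* (α :* a :+ α :* α :* (a :* a :* a :* a))) refl α y a) ⟩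
      χ (y * y * shiftCoefficient α a) ℤ.* χ (cubic α β a) ≡⟨ ℤ.*-comm (χ (y * y * shiftCoefficient α a)) (χ (cubic α β a)) ⟩
      χ (cubic α β a) ℤ.* χ (y * y * shiftCoefficient α a) ∎
    where
    open ≡-Reasoning
    u = α * (y * y * a)
    w = α * (y * a * a)
    difference : cubic α β y + cubic α β (y + a) ≡ (u + w) + cubic α β a
    difference = begin
        cubic α β y + cubic α β (y + a)   ≡⟨ solve 4 (λ α β y a → (α :* (y :* y :* y) :+ β :* y) :+ (α :* ((y :+ a) :* (y :+ a) :* (y :+ a)) :+ β :* (y :+ a))
                                              := ((α :* (y :* y :* a) :+ α :* (y :* a :* a)) :+ (α :* (a :* a :* a) :+ β :* a))
                                                 :+ (con 1 :+ con 1) :* (α :* (y :* y :* y) :+ β :* y :+ α :* (y :* y :* a) :+ α :* (y :* a :* a))) refl α β y a ⟩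
        (u + w) + cubic α β a + (1# + 1#) * r  ≡⟨ cong (λ t → (u + w) + cubic α β a + t * r) 1+1≡0 ⟩
        (u + w) + cubic α β a + 0# * r         ≡⟨ trans (cong ((u + w) + cubic α β a +_) (zeroˡ r)) (+-identityʳ _) ⟩
        (u + w) + cubic α β a                  ∎
      where
      r = α * (y * y * y) + β * y + α * (y * y * a) + α * (y * a * a)

  cubicSum² : ∀ α β → cubicSum α β ℤ.* cubicSum α β ≡ ∑ (λ a → χ (cubic α β a) ℤ.* ∑ (λ y → χ (y * shiftCoefficient α a)))
  cubicSum² α β = begin
      S ℤ.* S                                                   ≡⟨ sym (∑-*ʳ S g) ⟩
      ∑ (λ y → g y ℤ.* S)                                       ≡⟨ ∑-cong (λ y → sym (∑-*ˡ (g y) g)) ⟩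
      ∑ (λ y → ∑ (λ z → g y ℤ.* g z))                           ≡⟨ ∑-cong (λ y → sym (ℤ-Sum.∑-reindex (y +_) (y +_) (x+[x+y]≡y y) (x+[x+y]≡y y) (λ z → g y ℤ.* g z))) ⟩
      ∑ (λ y → ∑ (λ a → g y ℤ.* g (y + a)))                     ≡⟨ ∑-comm (λ y a → g y ℤ.* g (y + a)) ⟩
      ∑ (λ a → ∑ (λ y → g y ℤ.* g (y + a)))                     ≡⟨ ∑-cong (λ a → ∑-cong (λ y → χ-cubic-shift α β y a)) ⟩
      ∑ (λ a → ∑ (λ y → g a ℤ.* χ (y * y * shiftCoefficient α a)))  ≡⟨ ∑-cong (λ a → ∑-*ˡ (g a) (λ y → χ (y * y * shiftCoefficient α a))) ⟩
      ∑ (λ a → g a ℤ.* ∑ (λ y → χ (y * y * shiftCoefficient α a)))  ≡⟨ ∑-cong (λ a → cong (g a ℤ.*_) (∑-∘-square (λ z → χ (z * shiftCoefficient α a)))) ⟩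
      ∑ (λ a → g a ℤ.* ∑ (λ y → χ (y * shiftCoefficient α a)))      ∎
    where
    open ≡-Reasoning
    S = cubicSum α β
    g : Carrier → ℤ
    g = χ ∘ cubic α β

  InFq-cubic : ∀ {α β a} → InFq α → InFq β → InFq a → InFq (cubic α β a)
  InFq-cubic α∈Fq β∈Fq a∈Fq = InFq-+ (InFq-* α∈Fq (InFq-* (InFq-* a∈Fq a∈Fq) a∈Fq)) (InFq-* β∈Fq a∈Fq)

  cubicSum²-count : ∀ {α β} (zeros : List Carrier) → Unique zeros → (∀ a → shiftCoefficient α a ≡ 0# ⇔ a ∈ zeros) →
                    All InFq zeros → InFq α → InFq β → cubicSum α β ℤ.* cubicSum α β ≡ ℤ.+ N ℤ.* ℤ.+ length zeros
  cubicSum²-count {α} {β} zeros zeros-unique zeros-complete zeros⊆Fq α∈Fq β∈Fq = begin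
      cubicSum α β ℤ.* cubicSum α β                          ≡⟨ cubicSum² α β ⟩
      ∑ (λ a → χ (cubic α β a) ℤ.* ∑ (λ y → χ (y * C a)))    ≡⟨ ∑-cong (λ a → cong (χ (cubic α β a) ℤ.*_) (∑χ (C a))) ⟩
      ∑ (λ a → χ (cubic α β a) ℤ.* (ℤ.+ N ℤ.* 𝟙 (C a ≟ 0#))) ≡⟨ ∑-cong term ⟩
      ∑ (λ a → ℤ.+ N ℤ.* 𝟙 (a ∈? zeros))                     ≡⟨ ∑-*ˡ (ℤ.+ N) (λ a → 𝟙 (a ∈? zeros)) ⟩
      ℤ.+ N ℤ.* ∑ (λ a → 𝟙 (a ∈? zeros))                     ≡⟨ cong (ℤ._*_ (ℤ.+ N)) (ℤ-Sum.∑-𝟙-∈ _≟_ zeros zeros-unique) ⟩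
      ℤ.+ N ℤ.* ℤ.+ length zeros                             ∎
    where
    open ≡-Reasoning
    C = shiftCoefficient α
    rearrange : ∀ x n i → x ℤ.* (n ℤ.* i) ≡ n ℤ.* (i ℤ.* x)
    rearrange = solve-∀
    term : ∀ a → χ (cubic α β a) ℤ.* (ℤ.+ N ℤ.* 𝟙 (C a ≟ 0#)) ≡ ℤ.+ N ℤ.* 𝟙 (a ∈? zeros)
    term a = begin
        χ (cubic α β a) ℤ.* (ℤ.+ N ℤ.* 𝟙 (C a ≟ 0#))     ≡⟨ cong (λ i → χ (cubic α β a) ℤ.* (ℤ.+ N ℤ.* i)) (𝟙-cong (zeros-complete a) (C a ≟ 0#) (a ∈? zeros)) ⟩
        χ (cubic α β a) ℤ.* (ℤ.+ N ℤ.* 𝟙 (a ∈? zeros))   ≡⟨ rearrange (χ (cubic α β a)) (ℤ.+ N) (𝟙 (a ∈? zeros)) ⟩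
        ℤ.+ N ℤ.* (𝟙 (a ∈? zeros) ℤ.* χ (cubic α β a))   ≡⟨ cong (ℤ._*_ (ℤ.+ N)) (𝟙*f≡𝟙 (a ∈? zeros) (χ-Fq ∘ InFq-cubic α∈Fq β∈Fq ∘ All.lookup zeros⊆Fq)) ⟩
        ℤ.+ N ℤ.* 𝟙 (a ∈? zeros)                         ∎

  ∑Fq-cubicSum : ∀ {α} → InFq α → ∑Fq (cubicSum α) ≡ ℤ.+ q ℤ.* ℤ.+ q
  ∑Fq-cubicSum {α} α∈Fq = begin
      ∑ (λ β → 𝟙Fq β ℤ.* ∑ (λ y → χ (cubic α β y)))                  ≡⟨ ∑-cong (λ β → trans (cong (𝟙Fq β ℤ.*_) (∑-cong (λ y → χ-+ (α * (y * y * y)) (β * y))))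
                                                                                          (sym (∑-*ˡ (𝟙Fq β) (λ y → cube y ℤ.* χ (β * y))))) ⟩
      ∑ (λ β → ∑ (λ y → 𝟙Fq β ℤ.* (cube y ℤ.* χ (β * y))))           ≡⟨ ∑-comm (λ β y → 𝟙Fq β ℤ.* (cube y ℤ.* χ (β * y))) ⟩
      ∑ (λ y → ∑ (λ β → 𝟙Fq β ℤ.* (cube y ℤ.* χ (β * y))))           ≡⟨ ∑-cong (λ y → ∑-cong (λ β → swap (𝟙Fq β) (cube y) (χ (β * y)))) ⟩
      ∑ (λ y → ∑ (λ β → cube y ℤ.* (𝟙Fq β ℤ.* χ (β * y))))           ≡⟨ ∑-cong (λ y → trans (∑-*ˡ (cube y) (λ β → 𝟙Fq β ℤ.* χ (β * y))) (cong (cube y ℤ.*_) (∑Fq-χ y))) ⟩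
      ∑ (λ y → cube y ℤ.* (m ℤ.* 𝟙Fq y))                              ≡⟨ ∑-cong (λ y → swap (cube y) m (𝟙Fq y)) ⟩
      ∑ (λ y → m ℤ.* (cube y ℤ.* 𝟙Fq y))                              ≡⟨ ∑-*ˡ m (λ y → cube y ℤ.* 𝟙Fq y) ⟩
      m ℤ.* ∑ (λ y → cube y ℤ.* 𝟙Fq y)                                ≡⟨ cong (m ℤ.*_) (∑-cong (λ y → trans (ℤ.*-comm (cube y) (𝟙Fq y)) (𝟙*f≡𝟙 (InFq? y) (λ y∈Fq → χ-Fq (InFq-* α∈Fq (InFq-* (InFq-* y∈Fq y∈Fq) y∈Fq)))))) ⟩
      m ℤ.* m                                                         ≡⟨ cong₂ ℤ._*_ ∑𝟙Fq≡q ∑𝟙Fq≡q ⟩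
      ℤ.+ q ℤ.* ℤ.+ q                                                 ∎
    where
    open ≡-Reasoning
    m = ∑ 𝟙Fq
    cube : Carrier → ℤ
    cube y = χ (α * (y * y * y))
    swap : ∀ a b c → a ℤ.* (b ℤ.* c) ≡ b ℤ.* (a ℤ.* c)
    swap = solve-∀

  shiftCoefficient-factorisation : ∀ α a → shiftCoefficient α a ≡ (α * a) * (1# + α * (a * a * a))
  shiftCoefficient-factorisation α a = solve 2 (λ α a → α :* a :+ α :* α :* (a :* a :* a :* a) := (α :* a) :* (con 1 :+ α :* (a :* a :* a))) refl α a

  module _ {α : Carrier} (α∈Fq : InFq α) (α≢0 : ¬ α ≡ 0#) where

    -- b = α a^q a lies in F_q, and b³ = α (α a³)^q (α a³).
    α*a³≡1⇒cube : ∀ a → α * (a * a * a) ≡ 1# → IsCubeInFq α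
    α*a³≡1⇒cube a αa³≡1 = b , b∈Fq , b³≡α
      where
      open ≡-Reasoning
      a′ = a ^ q
      b = α * a′ * a
      αa′³≡1 : α * (a′ * a′ * a′) ≡ 1#
      αa′³≡1 = begin
          α * (a′ * a′ * a′)          ≡⟨ cong (_* (a′ * a′ * a′)) (sym α∈Fq) ⟩
          α ^ q * (a′ * a′ * a′)      ≡⟨ cong (α ^ q *_) (sym (trans (*-^ _ _ q) (cong (_* a′) (*-^ a a q)))) ⟩
          α ^ q * (a * a * a) ^ q     ≡⟨ sym (*-^ _ _ q) ⟩
          (α * (a * a * a)) ^ q       ≡⟨ cong (_^ q) αa³≡1 ⟩
          1# ^ q                      ≡⟨ 1^n≡1 q ⟩
          1#                          ∎
      b∈Fq : InFq b
      b∈Fq = begin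
          (α * a′ * a) ^ q            ≡⟨ *-^ _ _ q ⟩
          (α * a′) ^ q * a ^ q        ≡⟨ cong (_* a′) (*-^ _ _ q) ⟩
          α ^ q * a′ ^ q * a′         ≡⟨ cong₂ (λ u v → u * v * a′) α∈Fq ([x^q]^q≡x a) ⟩
          α * a * a′                  ≡⟨ solve 3 (λ α a b → α :* a :* b := α :* b :* a) refl α a a′ ⟩
          α * a′ * a                  ∎
      b³≡α : b ^ 3 ≡ α
      b³≡α = begin
          b ^ 3                                         ≡⟨ x^3≡x*x*x b ⟩
          b * b * b                                     ≡⟨ solve 3 (λ α a b → (α :* b :* a) :* (α :* b :* a) :* (α :* b :* a)
                                                             := α :* (α :* (b :* b :* b)) :* (α :* (a :* a :* a))) refl α a a′ ⟩
          α * (α * (a′ * a′ * a′)) * (α * (a * a * a))  ≡⟨ cong₂ (λ u v → α * u * v) αa′³≡1 αa³≡1 ⟩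
          α * 1# * 1#                                   ≡⟨ trans (*-identityʳ _) (*-identityʳ _) ⟩
          α                                             ∎

    shiftCoefficient-zeros-noncube : ¬ IsCubeInFq α → ∀ a → shiftCoefficient α a ≡ 0# ⇔ a ∈ 0# ∷ []
    shiftCoefficient-zeros-noncube ¬cube a = mk⇔ to from
      where
      to : shiftCoefficient α a ≡ 0# → a ∈ 0# ∷ []
      to C≡0 with x*y≡0⇒x≡0⊎y≡0 _ _ (trans (sym (shiftCoefficient-factorisation α a)) C≡0)
      ... | inj₂ 1+αa³≡0 = contradiction (α*a³≡1⇒cube a (sym (x+y≡0⇒x≡y 1+αa³≡0))) ¬cube
      ... | inj₁ αa≡0 with x*y≡0⇒x≡0⊎y≡0 α a αa≡0
      ...   | inj₁ α≡0 = contradiction α≡0 α≢0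
      ...   | inj₂ a≡0 = here a≡0
      from : a ∈ 0# ∷ [] → shiftCoefficient α a ≡ 0#
      from (here refl) = solve 1 (λ α → α :* con 0 :+ α :* α :* (con 0 :* con 0 :* con 0 :* con 0) := con 0) refl α

    cubicSum-noncube : ¬ IsCubeInFq α → ∀ {β} → InFq β → cubicSum α β ≡ ℤ.+ q
    cubicSum-noncube ¬cube = ∑Fq-maximal (cubicSum α) (ℤ.+ q) at-most-q (∑Fq-cubicSum α∈Fq)
      where
      at-most-q : ∀ {β} → InFq β → cubicSum α β ℤ.≤ ℤ.+ q
      at-most-q β∈Fq with i*i≡j*j⇒i≡j⊎i≡-j _ (ℤ.+ q) (trans (cubicSum²-count (0# ∷ []) ([] ∷ []) (shiftCoefficient-zeros-noncube ¬cube) (InFq-0 ∷ []) α∈Fq β∈Fq)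
                                                          (trans (ℤ.*-identityʳ (ℤ.+ N)) +N≡+q*+q))
      ... | inj₁ S≡q = ℤ.≤-reflexive S≡q
      ... | inj₂ S≡-q = subst (ℤ._≤ ℤ.+ q) (sym S≡-q) ℤ.neg-≤-pos

  module _ (k : ℕ) (e≡k*2 : e ≡ k ℕ.* 2) {α y : Carrier} (y∈Fq : InFq y) (y³≡α : y ^ 3 ≡ α) (α≢0 : ¬ α ≡ 0#) where

    private
      ω-properties = primitive-cube-root-of-unity (proj₁ (4^e≡4+3m e)) (proj₂ (4^e≡4+3m e))
      ω = proj₁ ω-properties
    open PrimitiveCubeRoot ω (proj₁ (proj₂ ω-properties)) (proj₂ (proj₂ ω-properties))

    x^4≡x⇒InFq : ∀ {x} → x ^ 4 ≡ x → InFq x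
    x^4≡x⇒InFq {x} x^4≡x = subst (λ n → x ^ n ≡ x) (sym q≡4^k) (x^[4^j]≡x k)
      where
      q≡4^k : q ≡ 4 ℕ.^ k
      q≡4^k = trans (cong (2 ℕ.^_) (trans e≡k*2 (ℕ.*-comm k 2))) (sym (ℕ.^-*-assoc 2 2 k))
      x^[4^j]≡x : ∀ j → x ^ (4 ℕ.^ j) ≡ x
      x^[4^j]≡x zero = x^1≡x x
      x^[4^j]≡x (suc j) = trans (^-* x 4 (4 ℕ.^ j)) (trans (cong (_^ (4 ℕ.^ j)) x^4≡x) (x^[4^j]≡x j))

    α∈Fq : InFq α
    α∈Fq = subst InFq y³≡α (InFq-* y∈Fq (InFq-* y∈Fq (InFq-* y∈Fq InFq-1)))

    y≢0 : ¬ y ≡ 0#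
    y≢0 refl = α≢0 (trans (sym y³≡α) (0^n≡0 3))

    v = inv y y≢0

    y*[x*v]≡x : ∀ x → y * (x * v) ≡ x
    y*[x*v]≡x x = trans (solve 3 (λ y x v → y :* (x :* v) := x :* (y :* v)) refl y x v) (trans (cong (x *_) (x*inv≡1 y y≢0)) (*-identityʳ x))

    zeros : List Carrier
    zeros = map (_* v) 𝔽₄

    shiftCoefficient-cube : ∀ a → shiftCoefficient α a ≡ (y * y) * (y * a + (y * a) ^ 4)
    shiftCoefficient-cube a = trans (cong (λ α → shiftCoefficient α a) (trans (sym y³≡α) (x^3≡x*x*x y)))
      (solve 2 (λ y a → (y :* y :* y) :* a :+ (y :* y :* y) :* (y :* y :* y) :* (a :* a :* a :* a)
                 := (y :* y) :* (y :* a :+ (y :* a) :* ((y :* a) :* ((y :* a) :* ((y :* a) :* con 1))))) refl y a)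

    shiftCoefficient-zeros-cube : ∀ a → shiftCoefficient α a ≡ 0# ⇔ a ∈ zeros
    shiftCoefficient-zeros-cube a = mk⇔ (λ C≡0 → from-𝔽₄ (Equivalence.to (x^4≡x⇔x∈𝔽₄ u) (u^4≡u C≡0)))
                                        (λ a∈zeros → u^4≡u⇒C≡0 (Equivalence.from (x^4≡x⇔x∈𝔽₄ u) (to-𝔽₄ a∈zeros)))
      where
      u = y * a
      u^4≡u : shiftCoefficient α a ≡ 0# → u ^ 4 ≡ u
      u^4≡u C≡0 with x*y≡0⇒x≡0⊎y≡0 (y * y) _ (trans (sym (shiftCoefficient-cube a)) C≡0)
      ... | inj₁ y²≡0 = contradiction y²≡0 (*-nonzero y≢0 y≢0)
      ... | inj₂ u+u⁴≡0 = sym (x+y≡0⇒x≡y u+u⁴≡0)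
      u^4≡u⇒C≡0 : u ^ 4 ≡ u → shiftCoefficient α a ≡ 0#
      u^4≡u⇒C≡0 u^4≡u = trans (shiftCoefficient-cube a) (trans (cong (λ t → (y * y) * (u + t)) u^4≡u) (trans (cong ((y * y) *_) (x+x≡0 u)) (zeroʳ _)))
      from-𝔽₄ : u ∈ 𝔽₄ → a ∈ zeros
      from-𝔽₄ u∈𝔽₄ = subst (_∈ zeros) (trans (*-assoc y a v) (y*[x*v]≡x a)) (∈-map⁺ (_* v) u∈𝔽₄)
      to-𝔽₄ : a ∈ zeros → u ∈ 𝔽₄
      to-𝔽₄ a∈zeros = from-preimage (∈-map⁻ (_* v) a∈zeros)
        where
        from-preimage : ∃ (λ b → b ∈ 𝔽₄ × a ≡ b * v) → u ∈ 𝔽₄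
        from-preimage (b , b∈𝔽₄ , a≡b*v) = subst (_∈ 𝔽₄) (sym (trans (cong (y *_) a≡b*v) (y*[x*v]≡x b))) b∈𝔽₄

    zeros-unique : Unique zeros
    zeros-unique = Unique.map⁺ (λ {b} {c} bv≡cv → *-cancelˡ v v≢0 (trans (*-comm v b) (trans bv≡cv (*-comm c v)))) 𝔽₄-unique
      where
      v≢0 : ¬ v ≡ 0#
      v≢0 v≡0 = 1≢0 (trans (sym (x*inv≡1 y y≢0)) (trans (cong (y *_) v≡0) (zeroʳ y)))

    zeros⊆Fq : All InFq zeros
    zeros⊆Fq = map⁺ (All.tabulate (λ {u} u∈𝔽₄ → InFq-* (x^4≡x⇒InFq (Equivalence.from (x^4≡x⇔x∈𝔽₄ u) u∈𝔽₄)) (InFq-inv y≢0 y∈Fq)))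

    cubicSum-cube-± : ∀ {β} → InFq β → cubicSum α β ≡ ℤ.+ (2 ℕ.* q) ⊎ cubicSum α β ≡ ℤ.- ℤ.+ (2 ℕ.* q)
    cubicSum-cube-± {β} β∈Fq = i*i≡j*j⇒i≡j⊎i≡-j _ _ (begin
        cubicSum α β ℤ.* cubicSum α β              ≡⟨ cubicSum²-count zeros zeros-unique shiftCoefficient-zeros-cube zeros⊆Fq α∈Fq β∈Fq ⟩
        ℤ.+ N ℤ.* ℤ.+ 4                           ≡⟨ cong (ℤ._* ℤ.+ 4) +N≡+q*+q ⟩
        ℤ.+ q ℤ.* ℤ.+ q ℤ.* ℤ.+ 4                 ≡⟨ regroup (ℤ.+ q) ⟩
        ℤ.+ 2 ℤ.* ℤ.+ q ℤ.* (ℤ.+ 2 ℤ.* ℤ.+ q)     ≡⟨ cong (λ i → i ℤ.* i) (sym (ℤ.pos-* 2 q)) ⟩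
        ℤ.+ (2 ℕ.* q) ℤ.* ℤ.+ (2 ℕ.* q)           ∎)
      where
      open ≡-Reasoning
      regroup : ∀ i → i ℤ.* i ℤ.* ℤ.+ 4 ≡ ℤ.+ 2 ℤ.* i ℤ.* (ℤ.+ 2 ℤ.* i)
      regroup = solve-∀

    cubicSum-cube-attains-2q : ∃ λ β → InFq β × cubicSum α β ≡ ℤ.+ (2 ℕ.* q)
    cubicSum-cube-attains-2q = pick (∑Fq≢⇒∃≢ (cubicSum α) (ℤ.- ℤ.+ (2 ℕ.* q)) (q*q≢q*c _ (ℤ.∣-i∣≡∣i∣ (ℤ.+ (2 ℕ.* q))) ∘ trans (sym (∑Fq-cubicSum α∈Fq))))
      where
      pick : ∃ (λ β → InFq β × ¬ cubicSum α β ≡ ℤ.- ℤ.+ (2 ℕ.* q)) → ∃ λ β → InFq β × cubicSum α β ≡ ℤ.+ (2 ℕ.* q)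
      pick (β , β∈Fq , S≢-2q) = β , β∈Fq , [ id , flip contradiction S≢-2q ]′ (cubicSum-cube-± β∈Fq)

    cubicSum-cube-attains--2q : ∃ λ β → InFq β × cubicSum α β ≡ ℤ.- ℤ.+ (2 ℕ.* q)
    cubicSum-cube-attains--2q = pick (∑Fq≢⇒∃≢ (cubicSum α) (ℤ.+ (2 ℕ.* q)) (q*q≢q*c _ refl ∘ trans (sym (∑Fq-cubicSum α∈Fq))))
      where
      pick : ∃ (λ β → InFq β × ¬ cubicSum α β ≡ ℤ.+ (2 ℕ.* q)) → ∃ λ β → InFq β × cubicSum α β ≡ ℤ.- ℤ.+ (2 ℕ.* q)
      pick (β , β∈Fq , S≢2q) = β , β∈Fq , [ flip contradiction S≢2q , id ]′ (cubicSum-cube-± β∈Fq)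

module WalshSpectrum (e : ℕ) .{{_ : NonZero e}} (F : FiniteField (2 ℕ.^ (2 ℕ.* e)))
                     (σinv : FiniteField.Carrier F → FiniteField.Carrier F)
                     (σ∘σinv : ∀ x → FieldDefs.σ e F (σinv x) ≡ x) (σinv∘σ : ∀ x → σinv (FieldDefs.σ e F x) ≡ x) where

  open CubicSum e F
  open ℤ-Sum using (∑; ∑-cong)

  W≡cubicSum : ∀ α {β} → InFq β → W (fα σinv α) β ≡ cubicSum α β
  W≡cubicSum α {β} β∈Fq = begin
      W (fα σinv α) β                                ≡⟨ ℤ-Sum.foldr-elements (λ x → sign (fα σinv α x + Tr (β * x))) ⟩
      ∑ (λ x → sign (Tr (α * σinv x ^ 3) + Tr (β * x)))  ≡⟨ ∑-cong (λ x → cong sign (sym (Tr-+ (α * σinv x ^ 3) (β * x)))) ⟩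
      ∑ g                                            ≡⟨ sym (ℤ-Sum.∑-reindex σ σinv σ∘σinv σinv∘σ g) ⟩
      ∑ (g ∘ σ)                                      ≡⟨ ∑-cong g∘σ≡χ∘cubic ⟩
      cubicSum α β                                   ∎
    where
    open ≡-Reasoning
    g : Carrier → ℤ
    g x = χ (α * σinv x ^ 3 + β * x)
    g∘σ≡χ∘cubic : ∀ y → g (σ y) ≡ χ (cubic α β y)
    g∘σ≡χ∘cubic y = begin
        χ (α * σinv (σ y) ^ 3 + β * σ y)               ≡⟨ cong (λ z → χ (α * z ^ 3 + β * σ y)) (σinv∘σ y) ⟩
        χ (α * y ^ 3 + β * ((y + y ^ d) + y ^ (d ℕ.* q)))  ≡⟨ cong χ (solve 5 (λ α β y a b → α :* (y :* (y :* (y :* con 1))) :+ β :* ((y :+ a) :+ b)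
                                                               := (α :* (y :* y :* y) :+ β :* y) :+ (β :* a :+ β :* b)) refl α β y (y ^ d) (y ^ (d ℕ.* q))) ⟩
        χ (cubic α β y + (z + β * y ^ (d ℕ.* q)))      ≡⟨ cong (λ w → χ (cubic α β y + (z + w))) β*y^[dq]≡z^q ⟩
        χ (cubic α β y + (z + z ^ q))                   ≡⟨ χ-+ _ _ ⟩
        χ (cubic α β y) ℤ.* χ (z + z ^ q)               ≡⟨ cong (χ (cubic α β y) ℤ.*_) (trans (χ-+ z (z ^ q)) (trans (cong (χ z ℤ.*_) (χ-^q z)) (χ*χ≡1 z))) ⟩
        χ (cubic α β y) ℤ.* 1ℤ                          ≡⟨ ℤ.*-identityʳ _ ⟩
        χ (cubic α β y)                                 ∎
      where
      z = β * y ^ d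
      β*y^[dq]≡z^q : β * y ^ (d ℕ.* q) ≡ z ^ q
      β*y^[dq]≡z^q = sym (trans (*-^ β (y ^ d) q) (cong₂ _*_ β∈Fq (sym (^-* y d q))))

  module _ {α : Carrier} (α∈Fq : InFq α) (α≢0 : ¬ α ≡ 0#) where

    W-noncube : ¬ IsCubeInFq α → ∀ β → InFq β → W (fα σinv α) β ≡ ℤ.+ q
    W-noncube ¬cube β β∈Fq = trans (W≡cubicSum α β∈Fq) (cubicSum-noncube α∈Fq α≢0 ¬cube β∈Fq)

    W-cube : ∀ k → e ≡ k ℕ.* 2 → IsCubeInFq α →
      (∀ β → InFq β → W (fα σinv α) β ≡ ℤ.+ (2 ℕ.* q) ⊎ W (fα σinv α) β ≡ ℤ.- ℤ.+ (2 ℕ.* q))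
      × Σ Carrier (λ β → InFq β × W (fα σinv α) β ≡ ℤ.+ (2 ℕ.* q))
      × Σ Carrier (λ β → InFq β × W (fα σinv α) β ≡ ℤ.- ℤ.+ (2 ℕ.* q))
    W-cube k e≡k*2 (y , y∈Fq , y³≡α) =
      (λ β β∈Fq → ⊎.map (trans (W≡cubicSum α β∈Fq)) (trans (W≡cubicSum α β∈Fq)) (cubicSum-cube-± k e≡k*2 y∈Fq y³≡α α≢0 β∈Fq)) ,
      via-W (cubicSum-cube-attains-2q k e≡k*2 y∈Fq y³≡α α≢0) ,
      via-W (cubicSum-cube-attains--2q k e≡k*2 y∈Fq y³≡α α≢0)
      where
      via-W : ∀ {c} → ∃ (λ β → InFq β × cubicSum α β ≡ c) → ∃ (λ β → InFq β × W (fα σinv α) β ≡ c)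
      via-W (β , β∈Fq , S≡c) = β , β∈Fq , trans (W≡cubicSum α β∈Fq) S≡c

open import Data.Nat using (_*_; _^_)
open import Data.Nat.Divisibility using (_∣_; divides)
open import Data.Integer using (+_; -_)

theorem1p2 : (e : ℕ) → .{{_ : NonZero e}} → 2 ∣ e → (F : FiniteField (2 ^ (2 * e))) →
    let open FieldDefs e F in
    (σinv : FiniteField.Carrier F → FiniteField.Carrier F) → (∀ x → σinv (σ x) ≡ x) → (∀ x → σ (σinv x) ≡ x) →
    (α : FiniteField.Carrier F) → InFq α → ¬ (α ≡ FiniteField.0# F) →
    (IsCubeInFq α →
      ((∀ β → InFq β → (W (fα σinv α) β ≡ + (2 * q) ⊎ W (fα σinv α) β ≡ - (+ (2 * q))))
      × Σ (FiniteField.Carrier F) (λ β → InFq β × W (fα σinv α) β ≡ + (2 * q))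
      × Σ (FiniteField.Carrier F) (λ β → InFq β × W (fα σinv α) β ≡ - (+ (2 * q)))))
    × (¬ IsCubeInFq α → ∀ β → InFq β → W (fα σinv α) β ≡ + q)
theorem1p2 e (divides k e≡k*2) F σinv σinv∘σ σ∘σinv α α∈Fq α≢0 = W-cube α∈Fq α≢0 k e≡k*2 , W-noncube α∈Fq α≢0
  where open WalshSpectrum e F σinv σ∘σinv σinv∘σ
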